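{- Let $m,n,s,k$ be positive integers with $m+s=n+k$, and let $\mathbf a=(a_1,\ldots,a_s)$, $\mathbf d=(d_1,\ldots,d_m)$, $\mathbf b=(b_1,\ldots,b_k)$, $\mathbf c=(c_1,\ldots,c_n)$ be partitions with $c_i\ne d_j$ for all $i,j$. Suppose $\mathbf g=(g_1,\ldots,g_{m+s})$ is a partition with $\mathbf g\prec''(\mathbf d,\mathbf a)$ and $\mathbf g\prec''(\mathbf c,\mathbf b)$. Then, with the notation of the context, $$c^{h'}\ge g_{z_{h'}+s},\qquad d^h\ge g_{z'_h+k},$$ and $$c^{h'}\ge a_s,\qquad d^h\ge b_k.$$
   Context: A partition is a finite nonincreasing sequence of integers. Empty sums are $0$; for any sequence $y_1,\ldots,y_w$ one sets $y_i=+\infty$ for $i\le0$ and $y_i=-\infty$ for $i>w$. Weak generalized majorization: for partitions $\mathbf d=(d_1,\ldots,d_p)$, $\mathbf a=(a_1,\ldots,a_s)$, $\mathbf g=(g_1,\ldots,g_{p+s})$, put $h_j=\min\{i\mid d_{i-j+1}<g_i\}$ for $j=1,\ldots,s$. We write $\mathbf g\prec''(\mathbf d,\mathbf a)$ if $d_i\ge g_{i+s}$ for $i=1,\ldots,p$; $\sum_{i=h_j+1}^{p+s}g_i\ge\sum_{i=h_j-j+1}^{p}d_i+\sum_{i=j+1}^{s}a_i$ for $j=1,\ldots,s$; and $\sum_{i=1}^{p+s}g_i\ge\sum_{i=1}^p d_i+\sum_{i=1}^s a_i$. $\mathbf e$ is the nonincreasing rearrangement of all entries of $\mathbf d$ and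 $\mathbf a$, where whenever some $d_i$ equals some $a_j$, the $a$'s of that value are placed before the $d$'s of that value; $\mathbf e'$ is defined the same way from $\mathbf c$ and $\mathbf b$ (equal $b$'s before equal $c$'s). Sets $S\subseteq\{1,\ldots,n\}$, $\Delta\subseteq\{1,\ldots,m\}$ are defined inductively: start with $S=\Delta=\emptyset$ and process all entries of $\mathbf c$ and $\mathbf d$ one at a time, from the smallest value to the largest; among equal entries of $\mathbf c$ (resp. $\mathbf d$) the one with the larger index is processed first. All sets and counts below refer to the decisions made so far. If the processed entry is $d_j$: set $q_j=s-\#\{i\in S\mid c_i<d_j\}+\#\{i>j\mid i\notin\Delta\}+1$. If $q_j>s$, put $j\in\Delta$. If $q_j\le s$, let $l\in S$ be the minimal index with $d_j>c_l$, and let $N=\#\{i\mid a_i>c_l\}-s+\#\{i\in S\mid i>l\}-\#\{i\notin\Delta\mid d_i<c_l\}+1$. (a) If $N\ge1$ and the entry $d_j$ of $\mathbf e$ is among the $N$ smallest entries of $\mathbf e$ that are larger than $c_l$, put $j\notin\Delta$. (b) Otherwise put $j\notin\Delta$ if $\sum_{i\in S,\,c_i<d_j}c_i\ge\sum_{i\notin\Delta,\,i>j}d_i+d_j+\sum_{i=q_j+1}^{s}a_i$, and $j\in\Delta$ if not. If the processed entry is $c_j$: dually, set $q'_j=k-\#\{i\in\Delta\mid d_i<c_j\}+\#\{i>j\mid i\notin S\}+1$. If $q'_j>k$, put $j\in S$. If $q'_j\le k$, let $l\in\Delta$ be the minimal index with $c_j>d_l$, and $N'=\#\{i\mid b_i>d_l\}-k+\#\{i\in\Delta\mid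 i>l\}-\#\{i\notin S\mid c_i<d_l\}+1$. (a) If $N'\ge1$ and the entry $c_j$ of $\mathbf e'$ is among the $N'$ smallest entries of $\mathbf e'$ larger than $d_l$, put $j\notin S$. (b) Otherwise put $j\notin S$ if $\sum_{i\in\Delta,\,d_i<c_j}d_i\ge\sum_{i\notin S,\,i>j}c_i+c_j+\sum_{i=q'_j+1}^{k}b_i$, and $j\in S$ if not. Let $h=|\Delta|$, $h'=|S|$; $d^1\ge\cdots\ge d^h$ are the $d_i$ with $i\in\Delta$ and $c^1\ge\cdots\ge c^{h'}$ the $c_i$ with $i\in S$. For $j=1,\ldots,h'$: $z_j=\#\{i\mid d_i>c^j\}$; for $j=1,\ldots,h$: $z'_j=\#\{i\mid c_i>d^j\}$. By convention $c^0=d^0=+\infty$ and $z_0=z'_0=0$. -}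

module Defs where

open import Data.Bool using (Bool; true; false; if_then_else_; not; _∧_; _∨_; T)
open import Data.Nat as ℕ using (ℕ; zero; suc)
open import Data.Integer as ℤ using (ℤ; +_; -[1+_]; _-_; _≤ᵇ_)
open import Data.Fin as Fin using (Fin; toℕ; fromℕ<)
open import Data.Sum using (_⊎_; inj₁; inj₂)
open import Data.Product using (_×_; _,_; proj₁; proj₂)
open import Data.List as List using (List; []; _∷_; allFin; reverse; filterᵇ; length; drop; foldr; map)
open import Data.Maybe using (Maybe; just; nothing)
open import Relation.Nullary using (yes; no; does)
open import Relation.Binary.PropositionalEquality using (_≡_)

-- A partition of length w: a nonincreasing sequence y_1 ≥ … ≥ y_w of
-- integers, represented as Fin w → ℤ (Fin index i stands for y_{i+1}).
Partition : {w : ℕ} → (Fin w → ℤ) → Set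
Partition {w} y = ∀ (i j : Fin w) → toℕ i ℕ.≤ toℕ j → y j ℤ.≤ y i

data ℤ∞ : Set where
  -∞  : ℤ∞
  fin : ℤ → ℤ∞
  +∞  : ℤ∞

data _≤∞_ : ℤ∞ → ℤ∞ → Set where
  -∞≤    : ∀ {x} → -∞ ≤∞ x
  fin≤fin : ∀ {x y} → x ℤ.≤ y → fin x ≤∞ fin y
  ≤+∞    : ∀ {x} → x ≤∞ +∞

_<ᶻ_ : ℤ → ℤ → Bool
x <ᶻ y = not (y ≤ᵇ x)

_≤ᵇ∞_ : ℤ∞ → ℤ∞ → Bool
-∞    ≤ᵇ∞ _     = true
_     ≤ᵇ∞ +∞    = true
fin x ≤ᵇ∞ fin y = x ≤ᵇ y
fin _ ≤ᵇ∞ -∞    = false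
+∞    ≤ᵇ∞ _     = false

_<ᵇ∞_ : ℤ∞ → ℤ∞ → Bool
x <ᵇ∞ y = not (y ≤ᵇ∞ x)

-- addition on ℤ∞ (the case +∞ + -∞ never arises below; set to +∞)
_⊕_ : ℤ∞ → ℤ∞ → ℤ∞
+∞    ⊕ _     = +∞
_     ⊕ +∞    = +∞
-∞    ⊕ _     = -∞
_     ⊕ -∞    = -∞
fin x ⊕ fin y = fin (x ℤ.+ y)

min∞ : ℤ∞ → ℤ∞ → ℤ∞
min∞ x y = if x ≤ᵇ∞ y then x else y

-- 1-based access y_i with the conventions y_i = +∞ (i ≤ 0), y_i = -∞ (i > w)
at : {w : ℕ} → (Fin w → ℤ) → ℤ → ℤ∞
at y -[1+ _ ]    = +∞
at y (+ zero)    = +∞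
at {w} y (+ suc i) with i ℕ.<? w
... | yes p = fin (y (fromℕ< p))
... | no _  = -∞

pos : {w : ℕ} → Fin w → ℤ
pos i = + suc (toℕ i)

sumSel : {w : ℕ} → (Fin w → Bool) → (Fin w → ℤ) → ℤ
sumSel {w} P y = foldr (λ i acc → if P i then y i ℤ.+ acc else acc) (+ 0) (allFin w)

#_ : {w : ℕ} → (Fin w → Bool) → ℕ
#_ {w} P = foldr (λ i acc → if P i then suc acc else acc) 0 (allFin w)

-- Σ_{i=lo}^{hi} y_i with the conventions above: empty sums are 0, a
-- nonempty range containing an index ≤ 0 gives +∞, one containing an
-- index > w gives -∞ (the two never happen simultaneously below).
sumR : {w : ℕ} → (Fin w → ℤ) → ℤ → ℤ → ℤ∞
sumR {w} y lo hi =
  if hi <ᶻ lo then fin (+ 0)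
  else if lo ≤ᵇ + 0 then +∞
  else if (+ w) <ᶻ hi then -∞
  else fin (sumSel (λ i → (lo ≤ᵇ pos i) ∧ (pos i ≤ᵇ hi)) y)

firstFrom : (ℕ → Bool) → ℕ → ℕ → ℕ
firstFrom P start zero = start
firstFrom P start (suc fuel) = if P start then start else firstFrom P (suc start) fuel

-- h_j = min { i | d_{i-j+1} < g_i }.  With the ±∞ conventions any such i
-- lies in 1 … p+j ⊆ 1 … p+s (i = p+j always qualifies), so searching
-- 1 … p+s computes the minimum.
hIdx : {p s : ℕ} → (Fin (p ℕ.+ s) → ℤ) → (Fin p → ℤ) → ℕ → ℕ
hIdx {p} {s} g d j =
  firstFrom (λ i → at d (+ i - + j ℤ.+ + 1) <ᵇ∞ at g (+ i)) 1 (p ℕ.+ s)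

_≺″[_,_] : {p s : ℕ} → (Fin (p ℕ.+ s) → ℤ) → (Fin p → ℤ) → (Fin s → ℤ) → Set
_≺″[_,_] {p} {s} g d a =
  (∀ (i : ℕ) → 1 ℕ.≤ i → i ℕ.≤ p → at g (+ (i ℕ.+ s)) ≤∞ at d (+ i))
  × (∀ (j : ℕ) → 1 ℕ.≤ j → j ℕ.≤ s →
       (sumR d (+ hIdx g d j - + j ℤ.+ + 1) (+ p) ⊕ sumR a (+ (j ℕ.+ 1)) (+ s))
         ≤∞ sumR g (+ (hIdx g d j ℕ.+ 1)) (+ (p ℕ.+ s)))
  × ((sumR d (+ 1) (+ p) ⊕ sumR a (+ 1) (+ s)) ≤∞ sumR g (+ 1) (+ (p ℕ.+ s)))

-- The rearrangement e of (d , a): entries tagged by their origin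
-- (inj₁ i : the entry a_i, inj₂ i : the entry d_i).  Merge of the two
-- nonincreasing lists; on equal values the a's come first; otherwise the
-- original order within each sequence is kept.

Entry : ℕ → ℕ → Set
Entry t p = ℤ × (Fin t ⊎ Fin p)

mergeE : {t p : ℕ} → List (Entry t p) → List (Entry t p) → List (Entry t p)
mergeE [] ys = ys
mergeE (x ∷ xs) [] = x ∷ xs
mergeE (x ∷ xs) (y ∷ ys) =
  if proj₁ y ≤ᵇ proj₁ x then x ∷ mergeE xs (y ∷ ys) else y ∷ mergeE (x ∷ xs) ys

rearr : {t p : ℕ} → (Fin t → ℤ) → (Fin p → ℤ) → List (Entry t p)
rearr {t} {p} extra own =
  mergeE (map (λ i → extra i , inj₁ i) (allFin t))
         (map (λ i → own i , inj₂ i) (allFin p))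

finEqᵇ : {w : ℕ} → Fin w → Fin w → Bool
finEqᵇ i j = toℕ i ℕ.≡ᵇ toℕ j

isOwn : {t p : ℕ} → Fin p → Entry t p → Bool
isOwn j (_ , inj₁ _) = false
isOwn j (_ , inj₂ i) = finEqᵇ i j

anyᵇ : {A : Set} → (A → Bool) → List A → Bool
anyᵇ P = foldr (λ x acc → P x ∨ acc) false

-- "the entry own_j of e is among the N smallest entries of e larger than x"
amongSmallest : {t p : ℕ} → List (Entry t p) → ℕ → ℤ → Fin p → Bool
amongSmallest e N x j =
  let L = filterᵇ (λ en → x <ᶻ proj₁ en) e
  in anyᵇ (isOwn j) (drop (length L ℕ.∸ N) L)

-- Generic form: processing own_j, where
--   own   = d, other = c, extra = a (t = s), T = S, U = Δ   (entry d_j), or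
--   own   = c, other = d, extra = b (t = k), T = Δ, U = S   (entry c_j).
-- Returns true iff j is put into U.

minIdx : {r : ℕ} → (Fin r → Bool) → Maybe (Fin r)
minIdx {r} P = foldr (λ i acc → if P i then just i else acc) nothing (allFin r)

decide : {p r t : ℕ} → (own : Fin p → ℤ) → (other : Fin r → ℤ) → (extra : Fin t → ℤ)
       → (T : Fin r → Bool) → (U : Fin p → Bool) → Fin p → Bool
decide {p} {r} {t} own other extra T U j =
  if (+ t) <ᶻ q then true
  else caseL (minIdx (λ i → T i ∧ (other i <ᶻ own j)))
  where
  q : ℤ
  q = + t - + (# (λ i → T i ∧ (other i <ᶻ own j)))
        ℤ.+ + (# (λ i → (toℕ j ℕ.<ᵇ toℕ i) ∧ not (U i))) ℤ.+ + 1

  condB : Bool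
  condB = (fin (sumSel (λ i → not (U i) ∧ (toℕ j ℕ.<ᵇ toℕ i)) own ℤ.+ own j)
           ⊕ sumR extra (q ℤ.+ + 1) (+ t))
          ≤ᵇ∞ fin (sumSel (λ i → (T i) ∧ (other i <ᶻ own j)) other)
  stepB : Bool
  stepB = not condB

  caseL : Maybe (Fin r) → Bool
  caseL nothing = stepB   -- unreachable: q ≤ t forces such an l to exist
  caseL (just l) =
    let N = + (# (λ i → other l <ᶻ extra i)) - + t
            ℤ.+ + (# (λ i → T i ∧ (toℕ l ℕ.<ᵇ toℕ i)))
            - + (# (λ i → not (U i) ∧ (own i <ᶻ other l))) ℤ.+ + 1
    in if (+ 1 ≤ᵇ N) ∧ amongSmallest (rearr extra own) ℤ.∣ N ∣ (other l) j
       then false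
       else stepB

-- Processing order: all entries of c and d from the smallest value to
-- the largest, equal entries of the same sequence by decreasing index.
-- For partitions (nonincreasing) with c_i ≠ d_j this is the merge of
-- d_m, …, d_1 and c_n, …, c_1 by increasing value.

mergeOrd : {m n : ℕ} → (Fin m → ℤ) → (Fin n → ℤ)
         → List (Fin m) → List (Fin n) → List (Fin m ⊎ Fin n)
mergeOrd d c [] ys = map inj₂ ys
mergeOrd d c (x ∷ xs) [] = map inj₁ (x ∷ xs)
mergeOrd d c (x ∷ xs) (y ∷ ys) =
  if d x <ᶻ c y then inj₁ x ∷ mergeOrd d c xs (y ∷ ys)
  else inj₂ y ∷ mergeOrd d c (x ∷ xs) ys

order : {m n : ℕ} → (Fin m → ℤ) → (Fin n → ℤ) → List (Fin m ⊎ Fin n)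
order {m} {n} d c = mergeOrd d c (reverse (allFin m)) (reverse (allFin n))

update : {w : ℕ} → (Fin w → Bool) → Fin w → Bool → (Fin w → Bool)
update U j v i = if finEqᵇ i j then v else U i

-- state: (S , Δ) as characteristic functions, S ⊆ {1..n}, Δ ⊆ {1..m}
State : ℕ → ℕ → Set
State m n = (Fin n → Bool) × (Fin m → Bool)

step : {m n s k : ℕ} → (Fin s → ℤ) → (Fin m → ℤ) → (Fin k → ℤ) → (Fin n → ℤ)
     → Fin m ⊎ Fin n → State m n → State m n
step a d b c (inj₁ j) (S , Δ) = S , update Δ j (decide d c a S Δ j)
step a d b c (inj₂ j) (S , Δ) = update S j (decide c d b Δ S j) , Δ

runSD : {m n s k : ℕ} → (Fin s → ℤ) → (Fin m → ℤ) → (Fin k → ℤ) → (Fin n → ℤ)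
      → State m n
runSD {m} {n} a d b c =
  List.foldl (λ st ev → step a d b c ev st) ((λ _ → false) , (λ _ → false)) (order d c)

setS : {m n s k : ℕ} → (Fin s → ℤ) → (Fin m → ℤ) → (Fin k → ℤ) → (Fin n → ℤ) → Fin n → Bool
setS a d b c = proj₁ (runSD a d b c)

setΔ : {m n s k : ℕ} → (Fin s → ℤ) → (Fin m → ℤ) → (Fin k → ℤ) → (Fin n → ℤ) → Fin m → Bool
setΔ a d b c = proj₂ (runSD a d b c)

-- c^{h'} = smallest c_i with i ∈ S (c^0 = +∞ if S = ∅), likewise d^h.

minSel : {w : ℕ} → (Fin w → Bool) → (Fin w → ℤ) → ℤ∞
minSel {w} P y = foldr (λ i acc → if P i then min∞ (fin (y i)) acc else acc) +∞ (allFin w)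

-- z = #{ i | y_i > x }  (gives 0 for x = +∞, matching z_0 = 0)
countAbove : {w : ℕ} → (Fin w → ℤ) → ℤ∞ → ℕ
countAbove y x = # (λ i → x <ᵇ∞ fin (y i))

module Submission where

open import Defs
open import Data.Bool using (Bool; true; false; if_then_else_; not; _∧_; T)
open import Data.Bool.Properties using (T-≡; T-∧; ∧-identityʳ; ∨-zeroʳ; not-involutive)
open import Data.Empty using (⊥; ⊥-elim)
open import Data.Nat as ℕ using (ℕ; zero; suc; _+_; _≤_; _<_; _∸_; z≤n; s≤s; z<s)
import Data.Nat.Properties as ℕP
open import Data.Integer as ℤ using (ℤ; +_)
import Data.Integer.Properties as ℤP
open import Data.Integer.Tactic.RingSolver using (solve-∀)
open import Data.Fin as Fin using (Fin; toℕ; fromℕ<; cast)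
import Data.Fin.Properties as FinP
open import Data.List using (List; []; _∷_; _++_; length; drop; filterᵇ; foldl; foldr; map; tabulate; reverse; allFin)
import Data.List.Properties as ListP
open import Data.List.Membership.Propositional using (_∈_)
import Data.List.Membership.Propositional.Properties as ∈P
open import Data.List.Relation.Unary.All as All using (All; []; _∷_)
import Data.List.Relation.Unary.All.Properties as AllP
open import Data.List.Relation.Unary.AllPairs as AllPairs using (AllPairs; []; _∷_)
import Data.List.Relation.Unary.AllPairs.Properties as AllPairsP
open import Data.List.Relation.Unary.Any using (here; there)
import Data.List.Relation.Unary.Any.Properties as AnyP
open import Data.Maybe as Maybe using (just; nothing)
open import Data.Product as Product using (Σ; _×_; _,_; proj₁; proj₂)
open import Data.Sum as Sum using (_⊎_; inj₁; inj₂)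
open import Function using (_∘_; id; _⇔_; mk⇔; Equivalence)
open import Relation.Nullary using (¬_; yes; no)
open import Relation.Nullary.Decidable using (T?)
open import Relation.Binary.Definitions using (tri<; tri≈; tri>)
open import Relation.Binary.PropositionalEquality hiding (J)

open Equivalence using (to; from)

-- Write the conditions of g ≺″ (d , a) 0-based and compare tails: call (u , h)
-- dominated when Σ_{i≥h} d_i + Σ_{i≥u} a_i ≤ Σ_{i≥u+h} g_i.  Condition (ii)
-- provides the dominated pairs (r+1 , h_{r+1}−r−1), condition (i) lets h grow
-- while g_{u+h} ≤ d_h, and a_u ≤ d_h (or d_h ≤ a_u) moves one index between u
-- and h.  Chains of such steps show that a_s ≤ x as soon as g_{s+z} ≤ x, where
-- z = #{i | d_i > x}, and that c_j can only be accepted into S while S is empty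
-- if g_{s+z} ≤ c_j, since otherwise rule (a) or (b) rejects it.
-- The construction first processes the smaller of d_m and c_n.  If it is d_m,
-- every d_i goes into Δ until the first c_j enters S; that c_j is c^{h'}, and
-- d^h = d_m, for which condition (i) gives g_{m+s} ≤ d_m.  The other case is
-- the same with (a , d) and (b , c) exchanged, which exchanges S and Δ.

-- Booleans and counting over Fin

¬T⇒≡false : ∀ {b} → ¬ T b → b ≡ false
¬T⇒≡false {true} ¬t = ⊥-elim (¬t _)
¬T⇒≡false {false} _ = refl

T-not⇒¬T : ∀ {b} → T (not b) → ¬ T b
T-not⇒¬T {true} ()

¬T⇒T-not : ∀ {b} → ¬ T b → T (not b)
¬T⇒T-not ¬t = subst (T ∘ not) (sym (¬T⇒≡false ¬t)) _

<ᶻ⇒< : ∀ {x y} → T (x <ᶻ y) → x ℤ.< y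
<ᶻ⇒< {x} {y} t = ℤP.≰⇒> (λ y≤x → subst (T ∘ not) (to T-≡ (ℤP.≤⇒≤ᵇ y≤x)) t)

<⇒<ᶻ : ∀ {x y} → x ℤ.< y → T (x <ᶻ y)
<⇒<ᶻ x<y = ¬T⇒T-not (ℤP.<⇒≱ x<y ∘ ℤP.≤ᵇ⇒≤)

≮ᶻ⇒≥ : ∀ {x y} → ¬ T (x <ᶻ y) → y ℤ.≤ x
≮ᶻ⇒≥ ¬t = ℤP.≮⇒≥ (¬t ∘ <⇒<ᶻ)

<ᶻ-flip : ∀ {x y} → x ≢ y → (x <ᶻ y) ≡ not (y <ᶻ x)
<ᶻ-flip {x} {y} x≢y with ℤP.<-cmp x y
... | tri< x<y _ _ = trans (to T-≡ (<⇒<ᶻ x<y)) (cong not (sym (¬T⇒≡false (ℤP.<-asym x<y ∘ <ᶻ⇒<))))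
... | tri≈ _ x≡y _ = ⊥-elim (x≢y x≡y)
... | tri> _ _ y<x = trans (¬T⇒≡false (ℤP.<-asym y<x ∘ <ᶻ⇒<)) (cong not (sym (to T-≡ (<⇒<ᶻ y<x))))

foldr-allFin-suc : ∀ {B : Set} n (F : Fin (suc n) → B → B) e →
  foldr F e (allFin (suc n)) ≡ F Fin.zero (foldr (F ∘ Fin.suc) e (allFin n))
foldr-allFin-suc n F e = cong (F Fin.zero) (begin
  foldr F e (tabulate Fin.suc)        ≡⟨ cong (foldr F e) (ListP.map-tabulate id Fin.suc) ⟨
  foldr F e (map Fin.suc (allFin n))  ≡⟨ ListP.foldr-map F Fin.suc e (allFin n) ⟩
  foldr (F ∘ Fin.suc) e (allFin n)    ∎)
  where open ≡-Reasoning

#-suc : ∀ {w} (P : Fin (suc w) → Bool) →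
  # P ≡ (if P Fin.zero then suc (# (P ∘ Fin.suc)) else # (P ∘ Fin.suc))
#-suc {w} P = foldr-allFin-suc w (λ i acc → if P i then suc acc else acc) 0

sumSel-suc : ∀ {w} (P : Fin (suc w) → Bool) (y : Fin (suc w) → ℤ) →
  sumSel P y ≡ (if P Fin.zero then y Fin.zero ℤ.+ sumSel (P ∘ Fin.suc) (y ∘ Fin.suc)
                else sumSel (P ∘ Fin.suc) (y ∘ Fin.suc))
sumSel-suc {w} P y = foldr-allFin-suc w (λ i acc → if P i then y i ℤ.+ acc else acc) (+ 0)

minSel-suc : ∀ {w} (P : Fin (suc w) → Bool) (y : Fin (suc w) → ℤ) →
  minSel P y ≡ (if P Fin.zero then min∞ (fin (y Fin.zero)) (minSel (P ∘ Fin.suc) (y ∘ Fin.suc))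
                else minSel (P ∘ Fin.suc) (y ∘ Fin.suc))
minSel-suc {w} P y = foldr-allFin-suc w (λ i acc → if P i then min∞ (fin (y i)) acc else acc) +∞

minIdx-suc : ∀ {w} (P : Fin (suc w) → Bool) →
  minIdx P ≡ (if P Fin.zero then just Fin.zero else Maybe.map Fin.suc (minIdx (P ∘ Fin.suc)))
minIdx-suc {w} P = trans (foldr-allFin-suc w (λ i acc → if P i then just i else acc) nothing)
  (cong (if P Fin.zero then just Fin.zero else_)
        (sym (ListP.foldr-fusion (Maybe.map Fin.suc) nothing shift (allFin w))))
  where
  shift : ∀ i acc → Maybe.map Fin.suc (if P (Fin.suc i) then just i else acc)
                  ≡ (if P (Fin.suc i) then just (Fin.suc i) else Maybe.map Fin.suc acc)
  shift i acc with P (Fin.suc i)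
  ... | true = refl
  ... | false = refl

#-cong : ∀ {w} {P Q : Fin w → Bool} → (∀ i → P i ≡ Q i) → # P ≡ # Q
#-cong {zero} _ = refl
#-cong {suc w} {P} {Q} P≗Q
  rewrite #-suc P | #-suc Q | P≗Q Fin.zero | #-cong {P = P ∘ Fin.suc} {Q ∘ Fin.suc} (P≗Q ∘ Fin.suc) = refl

#-none : ∀ {w} (P : Fin w → Bool) → (∀ i → ¬ T (P i)) → # P ≡ 0
#-none {zero} P _ = refl
#-none {suc w} P none rewrite #-suc P | ¬T⇒≡false (none Fin.zero) = #-none (P ∘ Fin.suc) (none ∘ Fin.suc)

#-complement : ∀ {w} (P : Fin w → Bool) → # P + # (not ∘ P) ≡ w
#-complement {zero} P = refl
#-complement {suc w} P rewrite #-suc P | #-suc (not ∘ P) with P Fin.zero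
... | true = cong suc (#-complement (P ∘ Fin.suc))
... | false = trans (ℕP.+-suc _ _) (cong suc (#-complement (P ∘ Fin.suc)))

#-≤ : ∀ {w} (P : Fin w → Bool) → # P ≤ w
#-≤ P = subst (# P ≤_) (#-complement P) (ℕP.m≤m+n _ _)

#-mono : ∀ {w} {P Q : Fin w → Bool} → (∀ i → T (P i) → T (Q i)) → # P ≤ # Q
#-mono {zero} _ = z≤n
#-mono {suc w} {P} {Q} P⊆Q rewrite #-suc P | #-suc Q with P Fin.zero in p0 | Q Fin.zero in q0
... | true  | true  = s≤s (#-mono (P⊆Q ∘ Fin.suc))
... | true  | false = ⊥-elim (subst T q0 (P⊆Q Fin.zero (subst T (sym p0) _)))
... | false | true  = ℕP.m≤n⇒m≤1+n (#-mono (P⊆Q ∘ Fin.suc))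
... | false | false = #-mono (P⊆Q ∘ Fin.suc)

Suffix : ∀ {w} → (Fin w → Bool) → ℕ → Set
Suffix P a = ∀ i → T (P i) ⇔ (a ≤ toℕ i)

suffix-suc : ∀ {w} {P : Fin (suc w)  → Bool} {a} → Suffix P (suc a) → Suffix (P ∘ Fin.suc) a
suffix-suc suf i = mk⇔ (ℕP.≤-pred ∘ to (suf (Fin.suc i))) (from (suf (Fin.suc i)) ∘ s≤s)

suffix-zero : ∀ {w} {P : Fin (suc w) → Bool} → Suffix P 0 → Suffix (P ∘ Fin.suc) 0
suffix-zero suf i = mk⇔ (λ _ → z≤n) (λ _ → from (suf (Fin.suc i)) z≤n)

#-suffix : ∀ {w} (P : Fin w → Bool) a → Suffix P a → # P ≡ w ∸ a
#-suffix {zero} P a _ = sym (ℕP.0∸n≡0 a)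
#-suffix {suc w} P zero suf rewrite #-suc P | to T-≡ (from (suf Fin.zero) z≤n) =
  cong suc (#-suffix (P ∘ Fin.suc) 0 (suffix-zero suf))
#-suffix {suc w} P (suc a) suf rewrite #-suc P | ¬T⇒≡false (λ t → ℕP.<⇒≱ (s≤s z≤n) (to (suf Fin.zero) t)) =
  #-suffix (P ∘ Fin.suc) a (suffix-suc suf)

DownClosed : ∀ {w} → (Fin w → Bool) → Set
DownClosed P = ∀ i i′ → toℕ i ≤ toℕ i′ → T (P i′) → T (P i)

#-downClosed : ∀ {w} (P : Fin w → Bool) → DownClosed P → ∀ i → T (P i) ⇔ (toℕ i < # P)
#-downClosed {suc w} P closed i rewrite #-suc P with P Fin.zero in p0
#-downClosed {suc w} P closed Fin.zero    | true = mk⇔ (λ _ → s≤s z≤n) (λ _ → subst T (sym p0) _)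
#-downClosed {suc w} P closed (Fin.suc i) | true =
  mk⇔ (s≤s ∘ to IH) (from IH ∘ ℕP.≤-pred)
  where IH = #-downClosed (P ∘ Fin.suc) (λ i i′ le → closed (Fin.suc i) (Fin.suc i′) (s≤s le)) i
... | false = mk⇔ (λ t → ⊥-elim (subst T p0 (closed Fin.zero i z≤n t)))
                  (λ i<0 → ⊥-elim (ℕP.n≮0 (subst (toℕ i <_) empty i<0)))
  where
  empty : # (P ∘ Fin.suc) ≡ 0
  empty = #-none (P ∘ Fin.suc) (λ j t → subst T p0 (closed Fin.zero (Fin.suc j) z≤n t))

minIdx-spec : ∀ {w} (P : Fin w → Bool) →
  (∀ i → ¬ T (P i)) ⊎
  (Σ (Fin w) λ l → minIdx P ≡ just l × T (P l) × (∀ i → toℕ i < toℕ l → ¬ T (P i)))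
minIdx-spec {zero} P = inj₁ λ ()
minIdx-spec {suc w} P rewrite minIdx-suc P with P Fin.zero in p0
... | true = inj₂ (Fin.zero , refl , subst T (sym p0) _ , λ _ ())
... | false with minIdx-spec (P ∘ Fin.suc)
...   | inj₁ none = inj₁ λ { Fin.zero t → subst T p0 t ; (Fin.suc i) → none i }
...   | inj₂ (l , e , Pl , below) rewrite e = inj₂ (Fin.suc l , refl , Pl ,
        λ { Fin.zero _ t → subst T p0 t ; (Fin.suc i) i<l → below i (ℕP.≤-pred i<l) })

minSel-none : ∀ {w} (P : Fin w → Bool) (y : Fin w → ℤ) → (∀ i → ¬ T (P i)) → minSel P y ≡ +∞
minSel-none {zero} P y _ = refl
minSel-none {suc w} P y none rewrite minSel-suc P y | ¬T⇒≡false (none Fin.zero) =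
  minSel-none (P ∘ Fin.suc) (y ∘ Fin.suc) (none ∘ Fin.suc)

minSel-selected : ∀ {w} (P : Fin w → Bool) (y : Fin w → ℤ) →
  minSel P y ≡ +∞ ⊎ Σ (Fin w) (λ i → T (P i) × minSel P y ≡ fin (y i))
minSel-selected {zero} P y = inj₁ refl
minSel-selected {suc w} P y rewrite minSel-suc P y
  with P Fin.zero in p0 | minSel-selected (P ∘ Fin.suc) (y ∘ Fin.suc)
... | false | inj₁ e = inj₁ e
... | false | inj₂ (i , Pi , e) = inj₂ (Fin.suc i , Pi , e)
... | true  | inj₁ e rewrite e = inj₂ (Fin.zero , subst T (sym p0) _ , refl)
... | true  | inj₂ (i , Pi , e) rewrite e with y Fin.zero ℤ.≤ᵇ y (Fin.suc i)
...   | true  = inj₂ (Fin.zero , subst T (sym p0) _ , refl)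
...   | false = inj₂ (Fin.suc i , Pi , refl)

minSel-attained : ∀ {w} (P : Fin w → Bool) (y : Fin w → ℤ) j → T (P j) →
  (∀ i → T (P i) → y j ℤ.≤ y i) → minSel P y ≡ fin (y j)
minSel-attained {suc w} P y Fin.zero Pj least rewrite minSel-suc P y | to T-≡ Pj
  with minSel-selected (P ∘ Fin.suc) (y ∘ Fin.suc)
... | inj₁ e rewrite e = refl
... | inj₂ (i , Pi , e) rewrite e | to T-≡ (ℤP.≤⇒≤ᵇ (least (Fin.suc i) Pi)) = refl
minSel-attained {suc w} P y (Fin.suc j) Pj least
  rewrite minSel-suc P y | minSel-attained (P ∘ Fin.suc) (y ∘ Fin.suc) j Pj (least ∘ Fin.suc)
  with P Fin.zero in p0
... | false = refl
... | true with y Fin.zero ℤ.≤ᵇ y (Fin.suc j) in le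
...   | false = refl
...   | true = cong fin (ℤP.≤-antisym (ℤP.≤ᵇ⇒≤ (subst T (sym le) _)) (least Fin.zero (subst T (sym p0) _)))

-- Sequences indexed by ℕ and their tail sums

-- 0-based indexing, with junk value 0 beyond the length
nth : ∀ {w} → (Fin w → ℤ) → ℕ → ℤ
nth {zero} y i = + 0
nth {suc w} y zero = y Fin.zero
nth {suc w} y (suc i) = nth (y ∘ Fin.suc) i

nth-toℕ : ∀ {w} (y : Fin w → ℤ) i → nth y (toℕ i) ≡ y i
nth-toℕ y Fin.zero = refl
nth-toℕ y (Fin.suc i) = nth-toℕ (y ∘ Fin.suc) i

nth-fromℕ< : ∀ {w} (y : Fin w → ℤ) {i} (i<w : i < w) → y (fromℕ< i<w) ≡ nth y i
nth-fromℕ< y {i} i<w = trans (sym (nth-toℕ y (fromℕ< i<w))) (cong (nth y) (FinP.toℕ-fromℕ< i<w))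

at-inside : ∀ {w} (y : Fin w → ℤ) i → i < w → at y (+ suc i) ≡ fin (nth y i)
at-inside {w} y i i<w with i ℕ.<? w
... | yes p = cong fin (nth-fromℕ< y p)
... | no ¬p = ⊥-elim (¬p i<w)

at-outside : ∀ {w} (y : Fin w → ℤ) i → w ≤ i → at y (+ suc i) ≡ -∞
at-outside {w} y i w≤i with i ℕ.<? w
... | yes p = ⊥-elim (ℕP.<⇒≱ p w≤i)
... | no _ = refl

Nonincreasing : (ℕ → ℤ) → ℕ → Set
Nonincreasing f w = ∀ i i′ → i ≤ i′ → i′ < w → f i′ ℤ.≤ f i

partition-nth : ∀ {w} (y : Fin w → ℤ) → Partition y → Nonincreasing (nth y) w
partition-nth y py i i′ i≤i′ i′<w =
  subst₂ ℤ._≤_ (nth-fromℕ< y i′<w) (nth-fromℕ< y i<w)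
    (py (fromℕ< i<w) (fromℕ< i′<w) (subst₂ _≤_ (sym (FinP.toℕ-fromℕ< _)) (sym (FinP.toℕ-fromℕ< _)) i≤i′))
  where i<w = ℕP.≤-<-trans i≤i′ i′<w

sumFrom : (ℕ → ℤ) → ℕ → ℕ → ℤ
sumFrom f lo zero = + 0
sumFrom f lo (suc n) = f lo ℤ.+ sumFrom f (suc lo) n

tailSum : (ℕ → ℤ) → ℕ → ℕ → ℤ
tailSum f w i = sumFrom f i (w ∸ i)

tailSum-step : ∀ f w i → i < w → tailSum f w i ≡ f i ℤ.+ tailSum f w (suc i)
tailSum-step f w i i<w rewrite ℕP.+-∸-assoc 1 i<w = refl

tailSum-beyond : ∀ f w i → w ≤ i → tailSum f w i ≡ + 0
tailSum-beyond f w i w≤i rewrite ℕP.m≤n⇒m∸n≡0 w≤i = refl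

sumFrom-cong : ∀ f g lo n → (∀ i → lo ≤ i → i < lo + n → f i ≡ g i) → sumFrom f lo n ≡ sumFrom g lo n
sumFrom-cong f g lo zero _ = refl
sumFrom-cong f g lo (suc n) f≗g =
  cong₂ ℤ._+_ (f≗g lo ℕP.≤-refl (ℕP.m<m+n lo z<s))
              (sumFrom-cong f g (suc lo) n (λ i lo<i i<n → f≗g i (ℕP.<⇒≤ lo<i) (subst (i <_) (sym (ℕP.+-suc lo n)) i<n)))

tailSum-cong : ∀ f g w i → (∀ j → j < w → f j ≡ g j) → tailSum f w i ≡ tailSum g w i
tailSum-cong f g w i f≗g with ℕP.≤-total w i
... | inj₁ w≤i = trans (tailSum-beyond f w i w≤i) (sym (tailSum-beyond g w i w≤i))
... | inj₂ i≤w = sumFrom-cong f g i (w ∸ i) (λ j _ j<w → f≗g j (subst (j <_) (ℕP.m+[n∸m]≡n i≤w) j<w))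

sumFrom-suc : ∀ f lo n → sumFrom f (suc lo) n ≡ sumFrom (f ∘ suc) lo n
sumFrom-suc f lo zero = refl
sumFrom-suc f lo (suc n) = cong (λ r → f (suc lo) ℤ.+ r) (sumFrom-suc f (suc lo) n)

sumSel-suffix : ∀ {w} (P : Fin w → Bool) (y : Fin w → ℤ) a → Suffix P a → sumSel P y ≡ tailSum (nth y) w a
sumSel-suffix {zero} P y a _ = sym (tailSum-beyond (nth y) 0 a z≤n)
sumSel-suffix {suc w} P y zero suf rewrite sumSel-suc P y | to T-≡ (from (suf Fin.zero) z≤n) =
  cong (λ r → y Fin.zero ℤ.+ r) (trans (sumSel-suffix (P ∘ Fin.suc) (y ∘ Fin.suc) 0 (suffix-zero suf))
                                (sym (sumFrom-suc (nth y) 0 w)))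
sumSel-suffix {suc w} P y (suc a) suf rewrite sumSel-suc P y | ¬T⇒≡false (λ t → ℕP.<⇒≱ (s≤s z≤n) (to (suf Fin.zero) t)) =
  trans (sumSel-suffix (P ∘ Fin.suc) (y ∘ Fin.suc) a (suffix-suc suf)) (sym (sumFrom-suc (nth y) a (w ∸ a)))

sumR-suffix : ∀ {w} (y : Fin w → ℤ) a → sumR y (+ suc a) (+ w) ≡ fin (tailSum (nth y) w a)
sumR-suffix {w} y a with suc a ℕ.≤ᵇ w in a<w
... | false = cong fin (sym (tailSum-beyond (nth y) w a (ℕP.≤-pred (ℕP.≰⇒> (subst T a<w ∘ ℕP.≤⇒≤ᵇ)))))
... | true rewrite to T-≡ (ℕP.≤⇒≤ᵇ (ℕP.≤-refl {w})) = cong fin (sumSel-suffix _ y a suf)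
  where
  suf : Suffix (λ i → (+ suc a ℤ.≤ᵇ pos i) ∧ (pos i ℤ.≤ᵇ + w)) a
  suf i = mk⇔ (λ t → ℕP.≤-pred (ℕP.≤ᵇ⇒≤ _ _ (proj₁ (to T-∧ t))))
              (λ a≤i → from T-∧ (ℕP.≤⇒≤ᵇ (s≤s a≤i) , ℕP.≤⇒≤ᵇ (FinP.toℕ<n i)))

sumR-nonpositive : ∀ {w} (y : Fin w → ℤ) lo → lo ℤ.≤ + 0 → sumR y lo (+ w) ≡ +∞
sumR-nonpositive {w} y lo lo≤0
  rewrite to T-≡ (ℤP.≤⇒≤ᵇ (ℤP.≤-trans lo≤0 (ℤ.+≤+ (z≤n {w})))) | to T-≡ (ℤP.≤⇒≤ᵇ lo≤0) = refl

sumR-suffix-+1 : ∀ {w} (y : Fin w → ℤ) a → sumR y (+ (a + 1)) (+ w) ≡ fin (tailSum (nth y) w a)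
sumR-suffix-+1 y a rewrite ℕP.+-comm a 1 = sumR-suffix y a

interval-induction : ∀ (P : ℕ → Set) {h₀} h₁ → h₀ ≤ h₁ → P h₀ →
  (∀ h → h₀ ≤ h → h < h₁ → P h → P (suc h)) → P h₁
interval-induction P h₁ h₀≤h₁ base next with ℕP.m≤n⇒m<n∨m≡n h₀≤h₁
... | inj₂ refl = base
interval-induction P (suc h) _ base next | inj₁ (s≤s h₀≤h) =
  next h h₀≤h ℕP.≤-refl
    (interval-induction P h h₀≤h base (λ h′ h₀≤h′ h′<h → next h′ h₀≤h′ (ℕP.m<n⇒m<1+n h′<h)))

-- The majorization g ≺″ (d , a), 0-based

firstFrom-minimal : ∀ P st f i → st ≤ i → i < firstFrom P st f → ¬ T (P i)
firstFrom-minimal P st zero i st≤i i<st = ⊥-elim (ℕP.<⇒≱ i<st st≤i)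
firstFrom-minimal P st (suc f) i st≤i i<first with P st in Pst
... | true = ⊥-elim (ℕP.<⇒≱ i<first st≤i)
... | false with st ℕ.≟ i
...   | yes refl = subst T Pst
...   | no st≢i = firstFrom-minimal P (suc st) f i (ℕP.≤∧≢⇒< st≤i st≢i) i<first

firstFrom-≤ : ∀ P st f i → st ≤ i → i < st + f → T (P i) → firstFrom P st f ≤ i
firstFrom-≤ P st zero i st≤i i<st _ = ⊥-elim (ℕP.<⇒≱ i<st (subst (_≤ i) (sym (ℕP.+-identityʳ st)) st≤i))
firstFrom-≤ P st (suc f) i st≤i i<end Pi with P st in Pst
... | true = st≤i
... | false with st ℕ.≟ i
...   | yes refl = ⊥-elim (subst T Pst Pi)
...   | no st≢i = firstFrom-≤ P (suc st) f i (ℕP.≤∧≢⇒< st≤i st≢i) (subst (i <_) (ℕP.+-suc st f) i<end) Pi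

firstFrom-bounded : ∀ P st f → firstFrom P st f ≤ st + f
firstFrom-bounded P st zero = ℕP.≤-reflexive (sym (ℕP.+-identityʳ st))
firstFrom-bounded P st (suc f) with P st
... | true = ℕP.m≤m+n st (suc f)
... | false = subst (firstFrom P (suc st) f ≤_) (sym (ℕP.+-suc st f)) (firstFrom-bounded P (suc st) f)

-- Condition (ii) of ≺″ at j = r+1, for 0-based sequences indexed by ℕ:
-- h is h_{r+1} − (r+1) of the paper, the least v with d_v < g_{r+v}
-- (where d_v = −∞ for v ≥ p).
record Crossing (p s : ℕ) (d a g : ℕ → ℤ) (r : ℕ) : Set where
  field
    h : ℕ
    tail-bound : tailSum d p h ℤ.+ tailSum a s (suc r) ℤ.≤ tailSum g (p + s) (suc r + h)
    h-least : ∀ v → r + v < p + s → (v < p → d v ℤ.< g (r + v)) → h ≤ v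
    below-h : ∀ v → v < h → (v < p) × (g (r + v) ℤ.≤ d v)

record Majorized (p s : ℕ) (d a g : ℕ → ℤ) : Set where
  field
    d-nonincreasing : Nonincreasing d p
    a-nonincreasing : Nonincreasing a s
    g-nonincreasing : Nonincreasing g (p + s)
    shifted : ∀ i → i < p → g (i + s) ℤ.≤ d i
    total : tailSum d p 0 ℤ.+ tailSum a s 0 ℤ.≤ tailSum g (p + s) 0
    partial : ∀ r → r < s → Crossing p s d a g r

fin≤fin⁻¹ : ∀ {x y} → fin x ≤∞ fin y → x ℤ.≤ y
fin≤fin⁻¹ (fin≤fin x≤y) = x≤y

shift-index : ∀ r v → + (suc r + v) ℤ.- + suc r ℤ.+ + 1 ≡ + suc v
shift-index r v = trans (cong (λ k → k ℤ.- + suc r ℤ.+ + 1) (ℤP.pos-+ (suc r) v)) (ring (+ suc r) (+ v))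
  where
  ring : ∀ a b → a ℤ.+ b ℤ.- a ℤ.+ + 1 ≡ + 1 ℤ.+ b
  ring = solve-∀

shift-index-nonpositive : ∀ h r → h ≤ r → + h ℤ.- + suc r ℤ.+ + 1 ℤ.≤ + 0
shift-index-nonpositive h r h≤r = subst (ℤ._≤ + 0) (ring (+ h) (+ r)) (ℤP.i≤j⇒i-j≤0 (ℤ.+≤+ h≤r))
  where
  ring : ∀ a b → a ℤ.- b ≡ a ℤ.- (+ 1 ℤ.+ b) ℤ.+ + 1
  ring = solve-∀

module _ {p s : ℕ} (d : Fin p → ℤ) (a : Fin s → ℤ) (g : Fin (p + s) → ℤ) where

  private
    W = p + s
    crosses : ℕ → ℕ → Bool
    crosses r i = at d (+ i ℤ.- + suc r ℤ.+ + 1) <ᵇ∞ at g (+ i)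

  crosses-inside : ∀ r v → r + v < W → v < p →
    crosses r (suc r + v) ≡ (nth d v <ᶻ nth g (r + v))
  crosses-inside r v rv<W v<p
    rewrite shift-index r v | at-inside g (r + v) rv<W | at-inside d v v<p = refl

  crosses-beyond : ∀ r v → r + v < W → p ≤ v → crosses r (suc r + v) ≡ true
  crosses-beyond r v rv<W p≤v
    rewrite shift-index r v | at-inside g (r + v) rv<W | at-outside d v p≤v = refl

  partial-≺″ : ∀ r → r < s →
    ((sumR d (+ hIdx g d (suc r) ℤ.- + suc r ℤ.+ + 1) (+ p) ⊕ sumR a (+ (suc r + 1)) (+ s))
       ≤∞ sumR g (+ (hIdx g d (suc r) + 1)) (+ W)) →
    Crossing p s (nth d) (nth a) (nth g) r
  partial-≺″ r r<s cond = record { h = H ∸ suc r ; tail-bound = inequality ; h-least = least ; below-h = below }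
    where
    H = hIdx g d (suc r)
    rhs : sumR g (+ (H + 1)) (+ W) ≡ fin (tailSum (nth g) W H)
    rhs = sumR-suffix-+1 g H
    -- h_{r+1} ≥ r+1, since otherwise the left-hand side of the condition is +∞
    r<H : suc r ≤ H
    r<H with suc r ℕ.≤? H
    ... | yes le = le
    ... | no nle with subst₂ (λ u v → (u ⊕ sumR a (+ (suc r + 1)) (+ s)) ≤∞ v)
                        (sumR-nonpositive d _ (shift-index-nonpositive H r (ℕP.≤-pred (ℕP.≰⇒> nle)))) rhs cond
    ...   | ()
    H≡ : suc r + (H ∸ suc r) ≡ H
    H≡ = ℕP.m+[n∸m]≡n r<H
    inequality : tailSum (nth d) p (H ∸ suc r) ℤ.+ tailSum (nth a) s (suc r) ℤ.≤ tailSum (nth g) W (suc r + (H ∸ suc r))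
    inequality = fin≤fin⁻¹ (subst₂ _≤∞_
      (cong₂ _⊕_ (trans (cong (λ k → sumR d (+ k ℤ.- + suc r ℤ.+ + 1) (+ p)) (sym H≡))
                         (trans (cong (λ k → sumR d k (+ p)) (shift-index r (H ∸ suc r))) (sumR-suffix d (H ∸ suc r))))
                 (sumR-suffix-+1 a (suc r)))
      (trans rhs (cong (fin ∘ tailSum (nth g) W) (sym H≡))) cond)
    least : ∀ v → r + v < W → (v < p → nth d v ℤ.< nth g (r + v)) → H ∸ suc r ≤ v
    least v rv<W d<g = ℕP.+-cancelˡ-≤ (suc r) _ v (subst (_≤ suc r + v) (sym H≡)
      (firstFrom-≤ (crosses r) 1 W (suc r + v) (s≤s z≤n) (s≤s rv<W) crossing))
      where
      crossing : T (crosses r (suc r + v))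
      crossing with p ℕ.≤? v
      ... | yes p≤v = subst T (sym (crosses-beyond r v rv<W p≤v)) _
      ... | no v≮p = subst T (sym (crosses-inside r v rv<W (ℕP.≰⇒> v≮p))) (<⇒<ᶻ (d<g (ℕP.≰⇒> v≮p)))
    below : ∀ v → v < H ∸ suc r → (v < p) × (nth g (r + v) ℤ.≤ nth d v)
    below v v<h = v<p , ℤP.≮⇒≥ (λ d<g → no-crossing (subst T (sym (crosses-inside r v rv<W v<p)) (<⇒<ᶻ d<g)))
      where
      i<H : suc r + v < H
      i<H = subst (suc r + v <_) H≡ (ℕP.+-monoʳ-< (suc r) v<h)
      no-crossing : ¬ T (crosses r (suc r + v))
      no-crossing = firstFrom-minimal (crosses r) 1 W (suc r + v) (s≤s z≤n) i<H
      rv<W : r + v < W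
      rv<W = ℕP.≤-pred (ℕP.≤-trans i<H (firstFrom-bounded (crosses r) 1 W))
      v<p : v < p
      v<p with p ℕ.≤? v
      ... | yes p≤v = ⊥-elim (no-crossing (subst T (sym (crosses-beyond r v rv<W p≤v)) _))
      ... | no v≮p = ℕP.≰⇒> v≮p

  ≺″⇒Majorized : Partition d → Partition a → Partition g → g ≺″[ d , a ] → Majorized p s (nth d) (nth a) (nth g)
  ≺″⇒Majorized pd pa pg (cond-i , cond-ii , cond-iii) = record
    { d-nonincreasing = partition-nth d pd
    ; a-nonincreasing = partition-nth a pa
    ; g-nonincreasing = partition-nth g pg
    ; shifted = λ i i<p → fin≤fin⁻¹ (subst₂ _≤∞_ (at-inside g (i + s) (ℕP.+-monoˡ-< s i<p)) (at-inside d i i<p)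
                                      (cond-i (suc i) (s≤s z≤n) i<p))
    ; total = fin≤fin⁻¹ (subst₂ (λ u v → (u ⊕ v) ≤∞ _) (sumR-suffix d 0) (sumR-suffix a 0)
                                (subst (_ ≤∞_) (sumR-suffix g 0) cond-iii))
    ; partial = λ r r<s → partial-≺″ r r<s (cond-ii (suc r) (s≤s z≤n) r<s)
    }

Majorized-cong : ∀ {p s d a g g′} → (∀ u → g u ≡ g′ u) → Majorized p s d a g → Majorized p s d a g′
Majorized-cong {p} {s} {d} {a} {g} {g′} g≗g′ M = record
  { d-nonincreasing = d-nonincreasing
  ; a-nonincreasing = a-nonincreasing
  ; g-nonincreasing = λ i i′ i≤i′ i′<W → subst₂ ℤ._≤_ (g≗g′ i′) (g≗g′ i) (g-nonincreasing i i′ i≤i′ i′<W)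
  ; shifted = λ i i<p → subst (ℤ._≤ d i) (g≗g′ (i + s)) (shifted i i<p)
  ; total = subst (_ ℤ.≤_) (tail≡ 0) total
  ; partial = λ r r<s → let C = partial r r<s in record
      { h = Crossing.h C
      ; tail-bound = subst (_ ℤ.≤_) (tail≡ (suc r + Crossing.h C)) (Crossing.tail-bound C)
      ; h-least = λ v rv<W d<g′ → Crossing.h-least C v rv<W (λ v<p → subst (d v ℤ.<_) (sym (g≗g′ (r + v))) (d<g′ v<p))
      ; below-h = λ v v<h → Product.map₂ (subst (ℤ._≤ d v) (g≗g′ (r + v))) (Crossing.below-h C v v<h)
      }
  }
  where
  open Majorized M
  tail≡ : ∀ i → tailSum g (p + s) i ≡ tailSum g′ (p + s) i
  tail≡ i = tailSum-cong g g′ (p + s) i (λ u _ → g≗g′ u)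

-- Consequences of majorization

+-cancelˡ-≤ : ∀ k x y → k ℤ.+ x ℤ.≤ k ℤ.+ y → x ℤ.≤ y
+-cancelˡ-≤ k x y k+x≤k+y = subst₂ ℤ._≤_ (ring k x) (ring k y) (ℤP.+-monoʳ-≤ (ℤ.- k) k+x≤k+y)
  where
  ring : ∀ k z → ℤ.- k ℤ.+ (k ℤ.+ z) ≡ z
  ring = solve-∀

+-cancelˡ-< : ∀ k x y → k ℤ.+ x ℤ.< k ℤ.+ y → x ℤ.< y
+-cancelˡ-< k x y k+x<k+y = subst₂ ℤ._<_ (ring k x) (ring k y) (ℤP.+-monoʳ-< (ℤ.- k) k+x<k+y)
  where
  ring : ∀ k z → ℤ.- k ℤ.+ (k ℤ.+ z) ≡ z
  ring = solve-∀

module MajorizedProperties {p s : ℕ} {d a g : ℕ → ℤ} (M : Majorized p s d a g) where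
  open Majorized M

  W = p + s

  Dominated : ℕ → ℕ → Set
  Dominated u h = tailSum d p h ℤ.+ tailSum a s u ℤ.≤ tailSum g W (u + h)

  index< : ∀ {u h} → u ≤ s → h < p → u + h < W
  index< {u} {h} u≤s h<p =
    ℕP.<-≤-trans (ℕP.+-monoʳ-< u h<p) (subst (u + p ≤_) (ℕP.+-comm s p) (ℕP.+-monoˡ-≤ p u≤s))

  private
    split-d : ∀ {h} u → h < p →
      d h ℤ.+ (tailSum d p (suc h) ℤ.+ tailSum a s u) ≡ tailSum d p h ℤ.+ tailSum a s u
    split-d {h} u h<p = trans (sym (ℤP.+-assoc (d h) (tailSum d p (suc h)) (tailSum a s u)))
                              (cong (ℤ._+ tailSum a s u) (sym (tailSum-step d p _ h<p)))

    split-g : ∀ {u h} → u ≤ s → h < p →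
      tailSum g W (u + h) ≡ g (u + h) ℤ.+ tailSum g W (u + suc h)
    split-g {u} {h} u≤s h<p =
      trans (tailSum-step g W (u + h) (index< u≤s h<p)) (cong (λ k → g (u + h) ℤ.+ tailSum g W k) (sym (ℕP.+-suc u h)))

  dominated-step : ∀ {u h} → u ≤ s → h < p → Dominated u h → g (u + h) ℤ.≤ d h → Dominated u (suc h)
  dominated-step {u} {h} u≤s h<p dom g≤d = +-cancelˡ-≤ (d h) _ _ (begin
    d h ℤ.+ (tailSum d p (suc h) ℤ.+ tailSum a s u)  ≡⟨ split-d u h<p ⟩
    tailSum d p h ℤ.+ tailSum a s u                  ≤⟨ dom ⟩
    tailSum g W (u + h)                              ≡⟨ split-g u≤s h<p ⟩
    g (u + h) ℤ.+ tailSum g W (u + suc h)            ≤⟨ ℤP.+-monoˡ-≤ _ g≤d ⟩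
    d h ℤ.+ tailSum g W (u + suc h)                  ∎)
    where open ℤP.≤-Reasoning

  dominated-step-strict : ∀ {u h} → u ≤ s → h < p → Dominated u h → g (u + h) ℤ.< d h →
    tailSum d p (suc h) ℤ.+ tailSum a s u ℤ.< tailSum g W (u + suc h)
  dominated-step-strict {u} {h} u≤s h<p dom g<d = +-cancelˡ-< (d h) _ _ (begin-strict
    d h ℤ.+ (tailSum d p (suc h) ℤ.+ tailSum a s u)  ≡⟨ split-d u h<p ⟩
    tailSum d p h ℤ.+ tailSum a s u                  ≤⟨ dom ⟩
    tailSum g W (u + h)                              ≡⟨ split-g u≤s h<p ⟩
    g (u + h) ℤ.+ tailSum g W (u + suc h)            <⟨ ℤP.+-monoˡ-< _ g<d ⟩
    d h ℤ.+ tailSum g W (u + suc h)                  ∎)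
    where open ℤP.≤-Reasoning

  dominated-extend : ∀ {u h₀} h₁ → u ≤ s → h₀ ≤ h₁ → h₁ ≤ p → Dominated u h₀ →
    (∀ h → h₀ ≤ h → h < h₁ → g (u + h) ℤ.≤ d h) → Dominated u h₁
  dominated-extend {u} h₁ u≤s h₀≤h₁ h₁≤p dom steps = interval-induction (Dominated u) h₁ h₀≤h₁ dom
    (λ h h₀≤h h<h₁ IH → dominated-step u≤s (ℕP.<-≤-trans h<h₁ h₁≤p) IH (steps h h₀≤h h<h₁))

  private
    expand-a : ∀ {u} h → u < s →
      tailSum d p (suc h) ℤ.+ tailSum a s u ≡ a u ℤ.+ tailSum d p (suc h) ℤ.+ tailSum a s (suc u)
    expand-a {u} h u<s = trans (cong (λ x → tailSum d p (suc h) ℤ.+ x) (tailSum-step a s u u<s))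
                               (ring (tailSum d p (suc h)) (a u) (tailSum a s (suc u)))
      where
      ring : ∀ D x A → D ℤ.+ (x ℤ.+ A) ≡ x ℤ.+ D ℤ.+ A
      ring = solve-∀

    expand-d : ∀ {h} u → h < p →
      tailSum d p h ℤ.+ tailSum a s (suc u) ≡ d h ℤ.+ tailSum d p (suc h) ℤ.+ tailSum a s (suc u)
    expand-d u h<p = cong (ℤ._+ tailSum a s (suc u)) (tailSum-step d p _ h<p)

  dominated-a→d : ∀ {u h} → u < s → h < p → Dominated (suc u) h → a u ℤ.≤ d h → Dominated u (suc h)
  dominated-a→d {u} {h} u<s h<p dom a≤d = begin
    tailSum d p (suc h) ℤ.+ tailSum a s u                ≡⟨ expand-a h u<s ⟩
    a u ℤ.+ tailSum d p (suc h) ℤ.+ tailSum a s (suc u)  ≤⟨ ℤP.+-monoˡ-≤ _ (ℤP.+-monoˡ-≤ _ a≤d) ⟩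
    d h ℤ.+ tailSum d p (suc h) ℤ.+ tailSum a s (suc u)  ≡⟨ expand-d u h<p ⟨
    tailSum d p h ℤ.+ tailSum a s (suc u)                ≤⟨ dom ⟩
    tailSum g W (suc u + h)                              ≡⟨ cong (tailSum g W) (ℕP.+-suc u h) ⟨
    tailSum g W (u + suc h)                              ∎
    where open ℤP.≤-Reasoning

  dominated-d→a : ∀ {u h} → u < s → h < p → Dominated u (suc h) → d h ℤ.≤ a u → Dominated (suc u) h
  dominated-d→a {u} {h} u<s h<p dom d≤a = begin
    tailSum d p h ℤ.+ tailSum a s (suc u)                ≡⟨ expand-d u h<p ⟩
    d h ℤ.+ tailSum d p (suc h) ℤ.+ tailSum a s (suc u)  ≤⟨ ℤP.+-monoˡ-≤ _ (ℤP.+-monoˡ-≤ _ d≤a) ⟩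
    a u ℤ.+ tailSum d p (suc h) ℤ.+ tailSum a s (suc u)  ≡⟨ expand-a h u<s ⟨
    tailSum d p (suc h) ℤ.+ tailSum a s u                ≤⟨ dom ⟩
    tailSum g W (u + suc h)                              ≡⟨ cong (tailSum g W) (ℕP.+-suc u h) ⟩
    tailSum g W (suc u + h)                              ∎
    where open ℤP.≤-Reasoning

  g-tail≤d-tail : ∀ z → z ≤ p → tailSum g W (s + z) ℤ.≤ tailSum d p z
  g-tail≤d-tail z z≤p = go (p ∸ z) z (ℕP.m+[n∸m]≡n z≤p)
    where
    go : ∀ k z → z + k ≡ p → tailSum g W (s + z) ℤ.≤ tailSum d p z
    go zero z z≡p = ℤP.≤-reflexive (trans
      (tailSum-beyond g W (s + z) (ℕP.≤-reflexive (trans (ℕP.+-comm p s) (cong (s ℕ.+_) p≡z))))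
      (sym (tailSum-beyond d p z (ℕP.≤-reflexive p≡z))))
      where p≡z = trans (sym z≡p) (ℕP.+-identityʳ z)
    go (suc k) z z+k≡p = begin
      tailSum g W (s + z)                    ≡⟨ tailSum-step g W (s + z) (index< ℕP.≤-refl z<p) ⟩
      g (s + z) ℤ.+ tailSum g W (suc s + z)  ≤⟨ ℤP.+-mono-≤ g≤d tail≤ ⟩
      d z ℤ.+ tailSum d p (suc z)            ≡⟨ tailSum-step d p z z<p ⟨
      tailSum d p z                          ∎
      where
      open ℤP.≤-Reasoning
      z<p : z < p
      z<p = subst (z <_) z+k≡p (ℕP.m<m+n z z<s)
      g≤d : g (s + z) ℤ.≤ d z
      g≤d = subst (λ i → g i ℤ.≤ d z) (ℕP.+-comm z s) (shifted z z<p)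
      tail≤ : tailSum g W (suc s + z) ℤ.≤ tailSum d p (suc z)
      tail≤ = subst (λ i → tailSum g W i ℤ.≤ tailSum d p (suc z)) (ℕP.+-suc s z)
                    (go k (suc z) (trans (sym (ℕP.+-suc z k)) z+k≡p))

  crossing : ∀ u → u < s → ℕ
  crossing u u<s = Crossing.h (partial u u<s)

  crossing-bound : ∀ {u} (u<s : u < s) e → e ≤ crossing u u<s → e ≤ p
  crossing-bound u<s zero _ = z≤n
  crossing-bound {u} u<s (suc e) e<h = proj₁ (Crossing.below-h (partial u u<s) e e<h)

  -- Induction on s − q: from the crossing of row q, move h up to J by a step
  -- where g ≤ d, and by the induction hypothesis for row q + 1 where g > d.
  dominated-at-crossing : ∀ {q J} → q < s → J < p → d J ℤ.< g (q + J) → a q ℤ.< d J → Dominated (suc q) J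
  dominated-at-crossing {q} q<s = go (s ∸ q) q (ℕP.m+[n∸m]≡n (ℕP.<⇒≤ q<s)) q<s
    where
    go : ∀ k q → q + k ≡ s → ∀ {J} → q < s → J < p → d J ℤ.< g (q + J) → a q ℤ.< d J → Dominated (suc q) J
    go zero q q≡s q<s = ⊥-elim (ℕP.<-irrefl (trans (sym (ℕP.+-identityʳ q)) q≡s) q<s)
    go (suc k) q q+k≡s {J} q<s J<p d<g a<d =
      interval-induction (Dominated (suc q)) J h≤J (Crossing.tail-bound (partial q q<s)) advance
      where
      h≤J : crossing q q<s ≤ J
      h≤J = Crossing.h-least (partial q q<s) J (index< (ℕP.<⇒≤ q<s) J<p) (λ _ → d<g)
      advance : ∀ h → crossing q q<s ≤ h → h < J → Dominated (suc q) h → Dominated (suc q) (suc h)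
      advance h _ h<J dom with g (suc q + h) ℤ.≤? d h | suc q ℕ.<? s
      ... | yes g≤d | _ = dominated-step q<s h<p dom g≤d
        where h<p = ℕP.<-trans h<J J<p
      ... | no g≰d | no 1+q≮s = ⊥-elim (g≰d (subst (λ i → g i ℤ.≤ d h) (trans (ℕP.+-comm h s) (cong (_+ h) s≡1+q))
                                                  (shifted h (ℕP.<-trans h<J J<p))))
        where s≡1+q = ℕP.≤-antisym (ℕP.≮⇒≥ 1+q≮s) q<s
      ... | no g≰d | yes 1+q<s =
        dominated-a→d 1+q<s h<p
          (go k (suc q) (trans (sym (ℕP.+-suc q k)) q+k≡s) 1+q<s h<p (ℤP.≰⇒> g≰d) a<d′) (ℤP.<⇒≤ a<d′)
        where
        h<p = ℕP.<-trans h<J J<p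
        a<d′ : a (suc q) ℤ.< d h
        a<d′ = ℤP.≤-<-trans (a-nonincreasing q (suc q) (ℕP.n≤1+n q) 1+q<s)
                            (ℤP.<-≤-trans a<d (d-nonincreasing h J (ℕP.<⇒≤ h<J) J<p))

  dominated⇒a≤g : ∀ {s₀ z} → s ≡ suc s₀ → z ≤ p → Dominated s₀ z → a s₀ ℤ.≤ g (s₀ + z)
  dominated⇒a≤g {s₀} {z} s≡ z≤p dom = +-cancelˡ-≤ (tailSum d p z) _ _ (begin
    tailSum d p z ℤ.+ a s₀                   ≡⟨ cong (λ x → tailSum d p z ℤ.+ x) a-tail ⟨
    tailSum d p z ℤ.+ tailSum a s s₀         ≤⟨ dom ⟩
    tailSum g W (s₀ + z)                     ≡⟨ tailSum-step g W (s₀ + z) s₀+z<W ⟩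
    g (s₀ + z) ℤ.+ tailSum g W (suc s₀ + z)  ≤⟨ ℤP.+-monoʳ-≤ (g (s₀ + z)) g-tail ⟩
    g (s₀ + z) ℤ.+ tailSum d p z             ≡⟨ ℤP.+-comm (g (s₀ + z)) (tailSum d p z) ⟩
    tailSum d p z ℤ.+ g (s₀ + z)             ∎)
    where
    open ℤP.≤-Reasoning
    s₀<s : s₀ < s
    s₀<s = subst (s₀ <_) (sym s≡) ℕP.≤-refl
    a-tail : tailSum a s s₀ ≡ a s₀
    a-tail = trans (tailSum-step a s s₀ s₀<s)
                   (trans (cong (λ i → a s₀ ℤ.+ tailSum a s i) (sym s≡))
                          (trans (cong (λ x → a s₀ ℤ.+ x) (tailSum-beyond a s s ℕP.≤-refl)) (ℤP.+-identityʳ (a s₀))))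
    g-tail : tailSum g W (suc s₀ + z) ℤ.≤ tailSum d p z
    g-tail = subst (λ k → tailSum g W (k + z) ℤ.≤ tailSum d p z) s≡ (g-tail≤d-tail z z≤p)
    s₀+z<W : s₀ + z < W
    s₀+z<W = ℕP.<-≤-trans (ℕP.+-monoˡ-< z s₀<s) (subst (s + z ≤_) (ℕP.+-comm s p) (ℕP.+-monoʳ-≤ s z≤p))

  -- If x < a_{s₀}, walking from (0 , 0) along the crossings and trading the
  -- d_i ≤ x for a_u > x reaches (s₀ , z), where dominated⇒a≤g gives a_{s₀} ≤ x.
  a-last≤ : ∀ {x z s₀} → s ≡ suc s₀ → z ≤ p → (∀ i → i < z → x ℤ.< d i) →
    (∀ i → z ≤ i → i < p → d i ℤ.≤ x) → g (s₀ + z) ℤ.≤ x → a s₀ ℤ.≤ x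
  a-last≤ {x} {z} {s₀} s≡ z≤p above below g≤x with a s₀ ℤ.≤? x
  ... | yes a≤x = a≤x
  ... | no a≰x = ⊥-elim (no-crossing-beyond s₀ 0 (ℕP.+-identityʳ s₀) s₀<s
                          (subst (_≤ crossing s₀ s₀<s) (sym (ℕP.+-identityʳ z)) z≤crossing))
    where
    x<a : x ℤ.< a s₀
    x<a = ℤP.≰⇒> a≰x
    s₀<s : s₀ < s
    s₀<s = subst (s₀ <_) (sym s≡) ℕP.≤-refl

    undominated : ∀ c u → u + c ≡ s₀ → z + c ≤ p → ¬ Dominated u (z + c)
    undominated zero u u≡s₀ _ dom = ℤP.<⇒≱ x<a (ℤP.≤-trans (dominated⇒a≤g s≡ z≤p dom′) g≤x)
      where dom′ = subst₂ Dominated (trans (sym (ℕP.+-identityʳ u)) u≡s₀) (ℕP.+-identityʳ z) dom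
    undominated (suc c) u u+c≡s₀ z+c<p dom =
      undominated c (suc u) (trans (sym (ℕP.+-suc u c)) u+c≡s₀) (ℕP.<⇒≤ z+c<p′)
        (dominated-d→a u<s z+c<p′ (subst (Dominated u) (ℕP.+-suc z c) dom) d≤a)
      where
      z+c<p′ = subst (_≤ p) (ℕP.+-suc z c) z+c<p
      u≤s₀ = subst (u ≤_) u+c≡s₀ (ℕP.m≤m+n u (suc c))
      u<s = ℕP.≤-<-trans u≤s₀ s₀<s
      d≤a : d (z + c) ℤ.≤ a u
      d≤a = ℤP.≤-trans (below (z + c) (ℕP.m≤m+n z c) z+c<p′)
                       (ℤP.≤-trans (ℤP.<⇒≤ x<a) (a-nonincreasing u s₀ u≤s₀ s₀<s))

    -- dominance up to z − 1 and the strict step at z contradict g-tail≤d-tail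
    early-crossing : ∀ z₁ → suc z₁ ≡ z → crossing s₀ s₀<s ≤ z₁ → ⊥
    early-crossing z₁ refl h≤z₁ = ℤP.<⇒≱ strict (ℤP.≤-trans (g-tail≤d-tail (suc z₁) z≤p) (ℤP.≤-reflexive tail≡))
      where
      1+s₀≤s : suc s₀ ≤ s
      1+s₀≤s = ℕP.≤-reflexive (sym s≡)
      z₁<p = ℕP.<-≤-trans ℕP.≤-refl z≤p
      steps : ∀ v → crossing s₀ s₀<s ≤ v → v < z₁ → g (suc s₀ + v) ℤ.≤ d v
      steps v _ v<z₁ = subst (λ i → g i ℤ.≤ d v) (trans (ℕP.+-comm v s) (cong (_+ v) s≡)) (shifted v (ℕP.<-trans v<z₁ z₁<p))
      dom : Dominated (suc s₀) z₁
      dom = dominated-extend z₁ 1+s₀≤s h≤z₁ (ℕP.<⇒≤ z₁<p) (Crossing.tail-bound (partial s₀ s₀<s)) steps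
      g<d : g (suc s₀ + z₁) ℤ.< d z₁
      g<d = ℤP.≤-<-trans (subst (λ i → g i ℤ.≤ x) (ℕP.+-suc s₀ z₁) g≤x) (above z₁ ℕP.≤-refl)
      strict : tailSum d p (suc z₁) ℤ.+ tailSum a s (suc s₀) ℤ.< tailSum g W (s + suc z₁)
      strict = subst (λ k → tailSum d p (suc z₁) ℤ.+ tailSum a s (suc s₀) ℤ.< tailSum g W (k + suc z₁)) (sym s≡)
                     (dominated-step-strict 1+s₀≤s z₁<p dom g<d)
      tail≡ : tailSum d p (suc z₁) ≡ tailSum d p (suc z₁) ℤ.+ tailSum a s (suc s₀)
      tail≡ = sym (trans (cong (λ x → tailSum d p (suc z₁) ℤ.+ x) (tailSum-beyond a s (suc s₀) (ℕP.≤-reflexive s≡)))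
                         (ℤP.+-identityʳ _))

    z≤crossing : z ≤ crossing s₀ s₀<s
    z≤crossing = ℕP.≮⇒≥ (λ h<z → early-crossing (ℕ.pred z) (ℕP.suc-pred z ⦃ ℕ.>-nonZero (ℕP.≤-<-trans z≤n h<z) ⦄)
                                                (ℕP.<⇒≤pred h<z))

    no-crossing-beyond : ∀ u c → u + c ≡ s₀ → (u<s : u < s) → z + c ≤ crossing u u<s → ⊥
    no-crossing-beyond zero c c≡s₀ 0<s z+c≤h =
      undominated c 0 c≡s₀ z+c≤p (dominated-extend (z + c) z≤n z≤n z+c≤p total
        (λ v _ v<z+c → proj₂ (Crossing.below-h (partial 0 0<s) v (ℕP.<-≤-trans v<z+c z+c≤h))))
      where z+c≤p = crossing-bound 0<s (z + c) z+c≤h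
    no-crossing-beyond (suc u) c u+c≡s₀ u<s z+c≤h with crossing u u<s′ ℕ.≤? z + c
      where u<s′ = ℕP.<-trans (ℕP.n<1+n u) u<s
    ... | yes h≤z+c = undominated c (suc u) u+c≡s₀ z+c≤p
          (dominated-extend (z + c) (ℕP.<⇒≤ u<s) h≤z+c z+c≤p (Crossing.tail-bound (partial u u<s′))
            (λ v _ v<z+c → proj₂ (Crossing.below-h (partial (suc u) u<s) v (ℕP.<-≤-trans v<z+c z+c≤h))))
      where
      u<s′ = ℕP.<-trans (ℕP.n<1+n u) u<s
      z+c≤p = crossing-bound u<s (z + c) z+c≤h
    ... | no h≰z+c = no-crossing-beyond u (suc c) (trans (ℕP.+-suc u c) u+c≡s₀) u<s′
          (subst (_≤ crossing u u<s′) (sym (ℕP.+-suc z c)) (ℕP.≰⇒> h≰z+c))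
      where u<s′ = ℕP.<-trans (ℕP.n<1+n u) u<s

-- The rearrangement e

length-filterᵇ-cons : ∀ {A : Set} (Q : A → Bool) x xs →
  length (filterᵇ Q (x ∷ xs)) ≡ (if Q x then suc (length (filterᵇ Q xs)) else length (filterᵇ Q xs))
length-filterᵇ-cons Q x xs with Q x
... | true = refl
... | false = refl

length-filterᵇ-tabulate : ∀ {A : Set} {n} (Q : A → Bool) (h : Fin n → A) → length (filterᵇ Q (tabulate h)) ≡ # (Q ∘ h)
length-filterᵇ-tabulate {n = zero} Q h = refl
length-filterᵇ-tabulate {n = suc n} Q h rewrite #-suc (Q ∘ h) with Q (h Fin.zero)
... | true = cong suc (length-filterᵇ-tabulate Q (h ∘ Fin.suc))
... | false = length-filterᵇ-tabulate Q (h ∘ Fin.suc)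

anyᵇ-drop : ∀ {A : Set} (Q : A → Bool) K pre x post → K ≤ length pre → T (Q x) → anyᵇ Q (drop K (pre ++ x ∷ post)) ≡ true
anyᵇ-drop Q zero [] x post _ Qx rewrite to T-≡ Qx = refl
anyᵇ-drop Q zero (y ∷ pre) x post _ Qx rewrite anyᵇ-drop Q zero pre x post z≤n Qx = ∨-zeroʳ (Q y)
anyᵇ-drop Q (suc K) (y ∷ pre) x post (s≤s K≤pre) Qx = anyᵇ-drop Q K pre x post K≤pre Qx

allPairs-tabulate : ∀ {A : Set} {n} (R : A → A → Set) (h : Fin n → A) →
  (∀ i i′ → toℕ i < toℕ i′ → R (h i) (h i′)) → AllPairs R (tabulate h)
allPairs-tabulate {n = zero} R h _ = []
allPairs-tabulate {n = suc n} R h ordered =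
  AllP.tabulate⁺ (λ i → ordered Fin.zero (Fin.suc i) (s≤s z≤n))
  ∷ allPairs-tabulate R (h ∘ Fin.suc) (λ i i′ i<i′ → ordered (Fin.suc i) (Fin.suc i′) (s≤s i<i′))

tabulate-split : ∀ {A : Set} {n} (P : A → Set) (h : Fin n → A) j → (∀ i → toℕ i < toℕ j → P (h i)) →
  Σ (List A) λ pre → Σ (List A) λ post → (tabulate h ≡ pre ++ h j ∷ post) × (length pre ≡ toℕ j) × All P pre
tabulate-split P h Fin.zero _ = [] , tabulate (h ∘ Fin.suc) , refl , refl , []
tabulate-split P h (Fin.suc j) before with tabulate-split P (h ∘ Fin.suc) j (λ i i<j → before (Fin.suc i) (s≤s i<j))
... | pre , post , split , len , all =
  h Fin.zero ∷ pre , post , cong (h Fin.zero ∷_) split , cong suc len , before Fin.zero (s≤s z≤n) ∷ all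

module _ {t p : ℕ} where

  private
    merge-cases : ∀ (x : Entry t p) xs y ys →
      (T (proj₁ y ℤ.≤ᵇ proj₁ x) × mergeE (x ∷ xs) (y ∷ ys) ≡ x ∷ mergeE xs (y ∷ ys))
      ⊎ (¬ T (proj₁ y ℤ.≤ᵇ proj₁ x) × mergeE (x ∷ xs) (y ∷ ys) ≡ y ∷ mergeE (x ∷ xs) ys)
    merge-cases x xs y ys with proj₁ y ℤ.≤ᵇ proj₁ x
    ... | true = inj₁ (_ , refl)
    ... | false = inj₂ ((λ ()) , refl)

    if-suc-+ : ∀ (b : Bool) m n → (if b then suc (m + n) else m + n) ≡ (if b then suc m else m) + n
    if-suc-+ true m n = refl
    if-suc-+ false m n = refl

    +-if-suc : ∀ (b : Bool) m n → m + (if b then suc n else n) ≡ (if b then suc (m + n) else m + n)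
    +-if-suc true m n = ℕP.+-suc m n
    +-if-suc false m n = refl

  length-filterᵇ-mergeE : ∀ (Q : Entry t p → Bool) xs ys →
    length (filterᵇ Q (mergeE xs ys)) ≡ length (filterᵇ Q xs) + length (filterᵇ Q ys)
  length-filterᵇ-mergeE Q [] ys = refl
  length-filterᵇ-mergeE Q (x ∷ xs) = go
    where
    #Q = length ∘ filterᵇ Q
    go : ∀ ys → #Q (mergeE (x ∷ xs) ys) ≡ #Q (x ∷ xs) + #Q ys
    go [] = sym (ℕP.+-identityʳ _)
    go (y ∷ ys) with merge-cases x xs y ys
    ... | inj₁ (_ , e) = begin
      #Q (mergeE (x ∷ xs) (y ∷ ys))                       ≡⟨ cong #Q e ⟩
      #Q (x ∷ mergeE xs (y ∷ ys))                         ≡⟨ length-filterᵇ-cons Q x _ ⟩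
      (if Q x then suc (#Q (mergeE xs (y ∷ ys))) else _)  ≡⟨ cong (λ k → if Q x then suc k else k) (length-filterᵇ-mergeE Q xs (y ∷ ys)) ⟩
      (if Q x then suc (#Q xs + #Q (y ∷ ys)) else _)      ≡⟨ if-suc-+ (Q x) _ _ ⟩
      (if Q x then suc (#Q xs) else #Q xs) + #Q (y ∷ ys)  ≡⟨ cong (_+ #Q (y ∷ ys)) (length-filterᵇ-cons Q x xs) ⟨
      #Q (x ∷ xs) + #Q (y ∷ ys)                           ∎
      where open ≡-Reasoning
    ... | inj₂ (_ , e) = begin
      #Q (mergeE (x ∷ xs) (y ∷ ys))                       ≡⟨ cong #Q e ⟩
      #Q (y ∷ mergeE (x ∷ xs) ys)                         ≡⟨ length-filterᵇ-cons Q y _ ⟩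
      (if Q y then suc (#Q (mergeE (x ∷ xs) ys)) else _)  ≡⟨ cong (λ k → if Q y then suc k else k) (go ys) ⟩
      (if Q y then suc (#Q (x ∷ xs) + #Q ys) else _)      ≡⟨ +-if-suc (Q y) _ _ ⟨
      #Q (x ∷ xs) + (if Q y then suc (#Q ys) else #Q ys)  ≡⟨ cong (#Q (x ∷ xs) ℕ.+_) (length-filterᵇ-cons Q y ys) ⟨
      #Q (x ∷ xs) + #Q (y ∷ ys)                           ∎
      where open ≡-Reasoning

  Nonincreasingᴱ : List (Entry t p) → Set
  Nonincreasingᴱ = AllPairs (λ e e′ → proj₁ e′ ℤ.≤ proj₁ e)

  #≥ : ℤ → List (Entry t p) → ℕ
  #≥ x = length ∘ filterᵇ (λ e → x ℤ.≤ᵇ proj₁ e)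

  private
    #≥-none : ∀ x es → All (λ e → proj₁ e ℤ.< x) es → #≥ x es ≡ 0
    #≥-none x [] [] = refl
    #≥-none x (e ∷ es) (e<x ∷ es<x) = trans (length-filterᵇ-cons (λ e → x ℤ.≤ᵇ proj₁ e) e es)
      (trans (cong (λ b → if b then suc (#≥ x es) else #≥ x es) (¬T⇒≡false (ℤP.<⇒≱ e<x ∘ ℤP.≤ᵇ⇒≤)))
             (#≥-none x es es<x))

    #≥-cons : ∀ x e es → #≥ x (e ∷ es) ≤ suc (#≥ x es)
    #≥-cons x e es rewrite length-filterᵇ-cons (λ e → x ℤ.≤ᵇ proj₁ e) e es with x ℤ.≤ᵇ proj₁ e
    ... | true = ℕP.≤-refl
    ... | false = ℕP.n≤1+n _

  SplitAround : ℤ → Entry t p → List (Entry t p) → ℕ → Set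
  SplitAround x e es n = Σ (List (Entry t p)) λ pre → Σ (List (Entry t p)) λ post →
    (es ≡ pre ++ e ∷ post) × All (λ e′ → x ℤ.≤ proj₁ e′) pre × (n ≤ length pre)

  mergeE-split : ∀ {x} e ys₂ → proj₁ e ≡ x → ∀ xs ys₁ →
    Nonincreasingᴱ xs → All (λ e′ → x ℤ.≤ proj₁ e′) ys₁ →
    SplitAround x e (mergeE xs (ys₁ ++ e ∷ ys₂)) (#≥ x xs + length ys₁)
  mergeE-split e ys₂ e≡x [] ys₁ _ ys₁≥x = ys₁ , ys₂ , refl , ys₁≥x , ℕP.≤-refl
  mergeE-split {x} e ys₂ e≡x (y ∷ xs) ys₁₀ (y≥xs ∷ sorted) ys₁₀≥x = go ys₁₀ ys₁₀≥x
    where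
    go : ∀ ys₁ → All (λ e′ → x ℤ.≤ proj₁ e′) ys₁ →
      SplitAround x e (mergeE (y ∷ xs) (ys₁ ++ e ∷ ys₂)) (#≥ x (y ∷ xs) + length ys₁)
    go [] [] with merge-cases y xs e ys₂
    ... | inj₁ (e≤y , eq) with mergeE-split e ys₂ e≡x xs [] sorted []
    ...   | pre , post , eq′ , pre≥x , len = y ∷ pre , post , trans eq (cong (y ∷_) eq′) ,
            subst (ℤ._≤ proj₁ y) e≡x (ℤP.≤ᵇ⇒≤ e≤y) ∷ pre≥x ,
            ℕP.≤-trans (ℕP.+-monoˡ-≤ 0 (#≥-cons x y xs)) (s≤s len)
    go [] [] | inj₂ (e≰y , eq) = [] , mergeE (y ∷ xs) ys₂ , eq , [] ,
            ℕP.≤-reflexive (trans (ℕP.+-identityʳ _)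
              (#≥-none x (y ∷ xs) (y<x ∷ All.map (λ le → ℤP.≤-<-trans le y<x) y≥xs)))
      where
      y<x : proj₁ y ℤ.< x
      y<x = subst (proj₁ y ℤ.<_) e≡x (ℤP.≰⇒> (e≰y ∘ ℤP.≤⇒≤ᵇ))
    go (z ∷ ys₁) (z≥x ∷ ys₁≥x) with merge-cases y xs z (ys₁ ++ e ∷ ys₂)
    ... | inj₁ (z≤y , eq) with mergeE-split e ys₂ e≡x xs (z ∷ ys₁) sorted (z≥x ∷ ys₁≥x)
    ...   | pre , post , eq′ , pre≥x , len = y ∷ pre , post , trans eq (cong (y ∷_) eq′) ,
            ℤP.≤-trans z≥x (ℤP.≤ᵇ⇒≤ z≤y) ∷ pre≥x ,
            ℕP.≤-trans (ℕP.+-monoˡ-≤ (suc (length ys₁)) (#≥-cons x y xs)) (s≤s len)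
    go (z ∷ ys₁) (z≥x ∷ ys₁≥x) | inj₂ (_ , eq) with go ys₁ ys₁≥x
    ...   | pre , post , eq′ , pre≥x , len = z ∷ pre , post , trans eq (cong (z ∷_) eq′) , z≥x ∷ pre≥x ,
            subst (_≤ suc (length pre)) (sym (ℕP.+-suc _ _)) (s≤s len)

module _ {t p : ℕ} (extra : Fin t → ℤ) (own : Fin p → ℤ) where

  private
    extraE : Fin t → Entry t p
    extraE i = extra i , inj₁ i
    ownE : Fin p → Entry t p
    ownE i = own i , inj₂ i

    rearr-tabulate : rearr extra own ≡ mergeE (tabulate extraE) (tabulate ownE)
    rearr-tabulate = cong₂ mergeE (ListP.map-tabulate id extraE) (ListP.map-tabulate id ownE)

  length-filterᵇ-rearr : ∀ y → length (filterᵇ (λ e → y <ᶻ proj₁ e) (rearr extra own))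
                               ≡ # (λ i → y <ᶻ extra i) + # (λ i → y <ᶻ own i)
  length-filterᵇ-rearr y = trans (cong (length ∘ filterᵇ Q) rearr-tabulate)
    (trans (length-filterᵇ-mergeE Q (tabulate extraE) (tabulate ownE))
           (cong₂ _+_ (length-filterᵇ-tabulate Q extraE) (length-filterᵇ-tabulate Q ownE)))
    where
    Q : Entry t p → Bool
    Q e = y <ᶻ proj₁ e

  -- In e, own_j is preceded by all extra entries ≥ own_j and by own_0 … own_{j-1}.
  rearr-amongSmallest : Partition extra → Partition own → ∀ j {y} → y ℤ.< own j →
    ∀ K → K ≤ # (λ i → own j ℤ.≤ᵇ extra i) + toℕ j →
    amongSmallest (rearr extra own) (length (filterᵇ (λ e → y <ᶻ proj₁ e) (rearr extra own)) ∸ K) y j ≡ true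
  rearr-amongSmallest extra-partition own-partition j {y} y<x K K≤
    with tabulate-split (λ e → own j ℤ.≤ proj₁ e) ownE j (λ i i<j → own-partition i j (ℕP.<⇒≤ i<j))
  ... | ys₁ , ys₂ , own-split , ys₁-length , ys₁≥x
    with mergeE-split (ownE j) ys₂ refl (tabulate extraE) ys₁
           (allPairs-tabulate _ extraE (λ i i′ i<i′ → extra-partition i i′ (ℕP.<⇒≤ i<i′))) ys₁≥x
  ... | pre , post , merge-split , pre≥x , pre-long = begin
    anyᵇ (isOwn j) (drop (length L ∸ (length L ∸ K)) L)       ≡⟨ cong (λ k → anyᵇ (isOwn j) (drop k L)) (ℕP.m∸[m∸n]≡n K≤L) ⟩
    anyᵇ (isOwn j) (drop K L)                                 ≡⟨ cong (anyᵇ (isOwn j) ∘ drop K) L≡ ⟩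
    anyᵇ (isOwn j) (drop K (pre ++ ownE j ∷ filterᵇ Q post))  ≡⟨ anyᵇ-drop (isOwn j) K pre (ownE j) _ K≤pre (ℕP.≡⇒≡ᵇ (toℕ j) (toℕ j) refl) ⟩
    true                                                      ∎
    where
    open ≡-Reasoning
    Q : Entry t p → Bool
    Q e = y <ᶻ proj₁ e
    L = filterᵇ Q (rearr extra own)
    K≤pre : K ≤ length pre
    K≤pre = ℕP.≤-trans K≤ (subst₂ (λ m n → m + n ≤ length pre) (length-filterᵇ-tabulate _ extraE) ys₁-length pre-long)
    L≡ : L ≡ pre ++ ownE j ∷ filterᵇ Q post
    L≡ = begin
      filterᵇ Q (rearr extra own)                 ≡⟨ cong (filterᵇ Q) (trans rearr-tabulate (trans (cong (mergeE (tabulate extraE)) own-split) merge-split)) ⟩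
      filterᵇ Q (pre ++ ownE j ∷ post)            ≡⟨ ListP.filter-++ (T? ∘ Q) pre (ownE j ∷ post) ⟩
      filterᵇ Q pre ++ filterᵇ Q (ownE j ∷ post)  ≡⟨ cong₂ _++_ (ListP.filter-all (T? ∘ Q) (All.map (λ x≤e → <⇒<ᶻ (ℤP.<-≤-trans y<x x≤e)) pre≥x))
                                                                 (ListP.filter-accept (T? ∘ Q) (<⇒<ᶻ y<x)) ⟩
      pre ++ ownE j ∷ filterᵇ Q post               ∎
    K≤L : K ≤ length L
    K≤L = ℕP.≤-trans K≤pre (subst (length pre ≤_) (cong length (sym L≡))
            (subst (length pre ≤_) (sym (ListP.length-++ pre)) (ℕP.m≤m+n (length pre) _)))

-- Processing an entry while the opposite set is empty

pos-<-∸ : ∀ a b c → + a ℤ.< + b ℤ.- + c → a + c < b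
pos-<-∸ a b c a<b-c = ℤP.drop‿+<+ (subst₂ ℤ._<_ (sym (ℤP.pos-+ a c)) (ring (+ b) (+ c)) (ℤP.+-monoˡ-< (+ c) a<b-c))
  where
  ring : ∀ b c → b ℤ.- c ℤ.+ c ≡ b
  ring = solve-∀

pos-∸-≤ : ∀ a b c → + b ℤ.- + c ℤ.≤ + a → b ≤ a + c
pos-∸-≤ a b c b-c≤a = ℤP.drop‿+≤+ (subst₂ ℤ._≤_ (ring (+ b) (+ c)) (sym (ℤP.pos-+ a c)) (ℤP.+-monoˡ-≤ (+ c) b-c≤a))
  where
  ring : ∀ b c → b ℤ.- c ℤ.+ c ≡ b
  ring = solve-∀

pos-∸ : ∀ {a b} → b ≤ a → + a ℤ.- + b ≡ + (a ∸ b)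
pos-∸ {a} {b} b≤a = trans (ℤP.m-n≡m⊖n a b) (ℤP.⊖-≥ b≤a)

private
  vanishes : ∀ {m n} → m ≡ n → + m ℤ.- + n ≡ + 0
  vanishes {m} refl = ℤP.+-inverseʳ (+ m)

  pos-+₃ : ∀ a b c → + (a + b + c) ≡ + a ℤ.+ + b ℤ.+ + c
  pos-+₃ a b c = trans (ℤP.pos-+ (a + b) c) (cong (ℤ._+ + c) (ℤP.pos-+ a b))

q-arithmetic : ∀ t₁ D X t₂ z J → D + z + t₂ ≡ X + suc J + t₁ →
  + t₁ ℤ.- + D ℤ.+ + X ℤ.+ + 1 ≡ + (t₂ + z) ℤ.- + J
q-arithmetic t₁ D X t₂ z J hyp = begin
  + t₁ ℤ.- + D ℤ.+ + X ℤ.+ + 1                                   ≡⟨ ring (+ t₁) (+ D) (+ X) (+ t₂) (+ z) (+ J) ⟩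
  (+ t₂ ℤ.+ + z) ℤ.- + J ℤ.+ (+ X ℤ.+ + suc J ℤ.+ + t₁ ℤ.- (+ D ℤ.+ + z ℤ.+ + t₂))
    ≡⟨ cong₂ (λ u v → u ℤ.- + J ℤ.+ v) (sym (ℤP.pos-+ t₂ z))
             (trans (cong₂ ℤ._-_ (sym (pos-+₃ X (suc J) t₁)) (sym (pos-+₃ D z t₂))) (vanishes (sym hyp))) ⟩
  + (t₂ + z) ℤ.- + J ℤ.+ + 0  ≡⟨ ℤP.+-identityʳ _ ⟩
  + (t₂ + z) ℤ.- + J          ∎
  where
  open ≡-Reasoning
  ring : ∀ t₁ D X t₂ z J → t₁ ℤ.- D ℤ.+ X ℤ.+ + 1 ≡ (t₂ ℤ.+ z) ℤ.- J ℤ.+ (X ℤ.+ (+ 1 ℤ.+ J) ℤ.+ t₁ ℤ.- (D ℤ.+ z ℤ.+ t₂))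
  ring = solve-∀

N-arithmetic : ∀ A t₁ B O Y t₂ z → B + suc z + t₂ ≡ Y + O + t₁ →
  + A ℤ.- + t₁ ℤ.+ + B ℤ.- + O ℤ.+ + 1 ≡ + (A + Y) ℤ.- + (t₂ + z)
N-arithmetic A t₁ B O Y t₂ z hyp = begin
  + A ℤ.- + t₁ ℤ.+ + B ℤ.- + O ℤ.+ + 1                           ≡⟨ ring (+ A) (+ t₁) (+ B) (+ O) (+ Y) (+ t₂) (+ z) ⟩
  (+ A ℤ.+ + Y) ℤ.- (+ t₂ ℤ.+ + z) ℤ.+ (+ B ℤ.+ + suc z ℤ.+ + t₂ ℤ.- (+ Y ℤ.+ + O ℤ.+ + t₁))
    ≡⟨ cong₃ (sym (ℤP.pos-+ A Y)) (sym (ℤP.pos-+ t₂ z))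
             (trans (cong₂ ℤ._-_ (sym (pos-+₃ B (suc z) t₂)) (sym (pos-+₃ Y O t₁))) (vanishes hyp)) ⟩
  + (A + Y) ℤ.- + (t₂ + z) ℤ.+ + 0  ≡⟨ ℤP.+-identityʳ _ ⟩
  + (A + Y) ℤ.- + (t₂ + z)          ∎
  where
  open ≡-Reasoning
  ring : ∀ A t₁ B O Y t₂ z → A ℤ.- t₁ ℤ.+ B ℤ.- O ℤ.+ + 1 ≡ (A ℤ.+ Y) ℤ.- (t₂ ℤ.+ z) ℤ.+ (B ℤ.+ (+ 1 ℤ.+ z) ℤ.+ t₂ ℤ.- (Y ℤ.+ O ℤ.+ t₁))
  ring = solve-∀
  cong₃ : ∀ {u u′ v v′ w w′} → u ≡ u′ → v ≡ v′ → w ≡ w′ → u ℤ.- v ℤ.+ w ≡ u′ ℤ.- v′ ℤ.+ w′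
  cong₃ refl refl refl = refl

-- own_j is processed while U = ∅ and every i with other_i < own_j is in T.
-- The theorem uses it with own = c, other = d, extra = b, U = S and T = Δ.
module Decision
  {p r t₁ t₂ t₀ : ℕ} (W≡ : r + t₂ ≡ p + t₁) (t₂≡ : t₂ ≡ suc t₀)
  {own : Fin p → ℤ} {other : Fin r → ℤ} {extra : Fin t₁ → ℤ} {a′ g : ℕ → ℤ}
  (own-partition : Partition own) (other-partition : Partition other) (extra-partition : Partition extra)
  (M : Majorized p t₁ (nth own) (nth extra) g) (M′ : Majorized r t₂ (nth other) a′ g)
  (distinct : ∀ i i′ → own i ≢ other i′)
  (T′ : Fin r → Bool) (U : Fin p → Bool) (j : Fin p)
  (U-empty : ∀ i → U i ≡ false) (T′-below : ∀ i → other i ℤ.< own j → T′ i ≡ true)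
  where

  private
    module M = MajorizedProperties M
    module M′ = MajorizedProperties M′

    x = own j
    J = toℕ j
    z = countAbove other (fin x)

    J<p : J < p
    J<p = FinP.toℕ<n j

    selected : Fin r → Bool
    selected i = T′ i ∧ (other i <ᶻ own j)

    q : ℤ
    q = + t₁ ℤ.- + (# selected) ℤ.+ + (# (λ i → (toℕ j ℕ.<ᵇ toℕ i) ∧ not (U i))) ℤ.+ + 1

    sums-ok : Bool
    sums-ok = (fin (sumSel (λ i → not (U i) ∧ (toℕ j ℕ.<ᵇ toℕ i)) own ℤ.+ own j) ⊕ sumR extra (q ℤ.+ + 1) (+ t₁))
              ≤ᵇ∞ fin (sumSel selected other)

    N : Fin r → ℤ
    N l = + (# (λ i → other l <ᶻ extra i)) ℤ.- + t₁ ℤ.+ + (# (λ i → T′ i ∧ (toℕ l ℕ.<ᵇ toℕ i)))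
          ℤ.- + (# (λ i → not (U i) ∧ (own i <ᶻ other l))) ℤ.+ + 1

    among : Fin r → Bool
    among l = (+ 1 ℤ.≤ᵇ N l) ∧ amongSmallest (rearr extra own) ℤ.∣ N l ∣ (other l) j

    decide-just : ∀ l → minIdx selected ≡ just l →
      decide own other extra T′ U j ≡ (if (+ t₁) <ᶻ q then true else (if among l then false else not sums-ok))
    decide-just l least rewrite least = refl

    above-closed : DownClosed (λ i → x <ᶻ other i)
    above-closed i i′ i≤i′ x<o = <⇒<ᶻ (ℤP.<-≤-trans (<ᶻ⇒< x<o) (other-partition i i′ i≤i′))

    selected-suffix : Suffix selected z
    selected-suffix i = mk⇔
      (λ sel → ℕP.≮⇒≥ (λ i<z → T-not⇒¬T (subst T flip (proj₂ (to T-∧ sel))) (from (#-downClosed _ above-closed i) i<z)))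
      (λ z≤i → from T-∧ (from T-≡ (T′-below i (<ᶻ⇒< (below z≤i))) , below z≤i))
      where
      flip : (other i <ᶻ x) ≡ not (x <ᶻ other i)
      flip = <ᶻ-flip (distinct j i ∘ sym)
      below : z ≤ toℕ i → T (other i <ᶻ x)
      below z≤i = subst T (sym flip) (¬T⇒T-not (ℕP.≤⇒≯ z≤i ∘ to (#-downClosed _ above-closed i)))

    z≤r : z ≤ r
    z≤r = #-≤ _

    q≡ : q ≡ + (t₂ + z) ℤ.- + J
    q≡ = q-arithmetic t₁ (# selected) (# (λ i → (toℕ j ℕ.<ᵇ toℕ i) ∧ not (U i))) t₂ z J (begin
      # selected + z + t₂     ≡⟨ cong (λ k → k + z + t₂) (#-suffix selected z selected-suffix) ⟩
      r ∸ z + z + t₂          ≡⟨ cong (_+ t₂) (ℕP.m∸n+n≡m z≤r) ⟩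
      r + t₂                  ≡⟨ W≡ ⟩
      p + t₁                  ≡⟨ cong (_+ t₁) (ℕP.m∸n+n≡m J<p) ⟨
      p ∸ suc J + suc J + t₁  ≡⟨ cong (λ k → k + suc J + t₁) (#-suffix after? (suc J) after) ⟨
      # after? + suc J + t₁   ∎)
      where
      open ≡-Reasoning
      after? : Fin p → Bool
      after? i = (toℕ j ℕ.<ᵇ toℕ i) ∧ not (U i)
      after : Suffix after? (suc J)
      after i rewrite U-empty i | ∧-identityʳ (toℕ j ℕ.<ᵇ toℕ i) = mk⇔ (ℕP.<ᵇ⇒< _ _) ℕP.<⇒<ᵇ

    t₀+z<W : t₀ + z < p + t₁
    t₀+z<W = subst (t₀ + z <_) W≡ (ℕP.<-≤-trans (ℕP.+-monoˡ-< z (subst (t₀ <_) (sym t₂≡) ℕP.≤-refl))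
               (subst (t₂ + z ≤_) (ℕP.+-comm t₂ r) (ℕP.+-monoʳ-≤ t₂ z≤r)))

    bound-if-q-large : T ((+ t₁) <ᶻ q) → g (t₀ + z) ℤ.≤ x
    bound-if-q-large t₁<q = subst (g (t₀ + z) ℤ.≤_) (nth-toℕ own j)
      (ℤP.≤-trans (Majorized.g-nonincreasing M (J + t₁) (t₀ + z) J+t₁≤t₀+z t₀+z<W) (Majorized.shifted M J J<p))
      where
      J+t₁≤t₀+z : J + t₁ ≤ t₀ + z
      J+t₁≤t₀+z = ℕP.≤-pred (subst (λ k → suc (J + t₁) ≤ k + z) t₂≡
                    (subst (λ k → suc k ≤ t₂ + z) (ℕP.+-comm t₁ J) (pos-<-∸ t₁ (t₂ + z) J (subst (+ t₁ ℤ.<_) q≡ (<ᶻ⇒< t₁<q)))))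

    -- with nothing selected, z = r and then q = p + t₁ − J > t₁
    something-selected : (∀ i → ¬ T (selected i)) → ¬ T ((+ t₁) <ᶻ q) → ⊥
    something-selected none q≤t₁ = ℕP.<⇒≱ J<p (ℕP.+-cancelʳ-≤ t₁ p J (subst (_≤ J + t₁) t₂+z≡ t₂+z≤J+t₁))
      where
      t₂+z≤J+t₁ : t₂ + z ≤ J + t₁
      t₂+z≤J+t₁ = subst (t₂ + z ≤_) (ℕP.+-comm t₁ J) (pos-∸-≤ t₁ (t₂ + z) J (subst (ℤ._≤ + t₁) q≡ (≮ᶻ⇒≥ q≤t₁)))
      z≡r : z ≡ r
      z≡r = ℕP.≤-antisym z≤r (ℕP.m∸n≡0⇒m≤n (trans (sym (#-suffix selected z selected-suffix)) (#-none selected none)))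
      t₂+z≡ : t₂ + z ≡ p + t₁
      t₂+z≡ = trans (cong (t₂ ℕ.+_) z≡r) (trans (ℕP.+-comm t₂ r) W≡)

    #extra≥x = # (λ i → x ℤ.≤ᵇ extra i)

    among-if-few : ∀ l → T (selected l) → (∀ i → toℕ i < toℕ l → ¬ T (selected i)) →
      t₂ + z ≤ #extra≥x + J → T (among l)
    among-if-few l l-selected l-least few =
      subst (λ n → T ((+ 1 ℤ.≤ᵇ n) ∧ amongSmallest (rearr extra own) ℤ.∣ n ∣ y j)) (sym N≡)
        (from T-∧ (ℕP.≤⇒≤ᵇ (ℕP.m<n⇒0<n∸m few<L) ,
                   from T-≡ (rearr-amongSmallest extra own extra-partition own-partition j y<x (t₂ + z) few)))
      where
      y = other l
      y<x : y ℤ.< x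
      y<x = <ᶻ⇒< (proj₂ (to T-∧ l-selected))
      l≡z : toℕ l ≡ z
      l≡z = ℕP.≤-antisym (ℕP.≮⇒≥ (λ z<l → l-least (fromℕ< (ℕP.<-trans z<l (FinP.toℕ<n l)))
                                               (subst (_< toℕ l) (sym (FinP.toℕ-fromℕ< _)) z<l)
                                               (from (selected-suffix _) (ℕP.≤-reflexive (sym (FinP.toℕ-fromℕ< _))))))
                         (to (selected-suffix l) l-selected)
      #own>y = # (λ i → y <ᶻ own i)
      L = length (filterᵇ (λ e → y <ᶻ proj₁ e) (rearr extra own))
      own>y-closed : DownClosed (λ i → y <ᶻ own i)
      own>y-closed i i′ i≤i′ y<o = <⇒<ᶻ (ℤP.<-≤-trans (<ᶻ⇒< y<o) (own-partition i i′ i≤i′))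
      after-l : # (λ i → T′ i ∧ (toℕ l ℕ.<ᵇ toℕ i)) ≡ r ∸ suc (toℕ l)
      after-l = #-suffix _ (suc (toℕ l)) (λ i → mk⇔ (ℕP.<ᵇ⇒< _ _ ∘ proj₂ ∘ to T-∧)
        (λ l<i → from T-∧ (from T-≡ (T′-below i (ℤP.≤-<-trans (other-partition l i (ℕP.<⇒≤ l<i)) y<x)) , ℕP.<⇒<ᵇ l<i)))
      own-split : #own>y + # (λ i → not (U i) ∧ (own i <ᶻ y)) ≡ p
      own-split = trans (cong (#own>y ℕ.+_) (trans (#-cong (λ i → cong (λ b → not b ∧ (own i <ᶻ y)) (U-empty i)))
                                                  (#-cong (λ i → <ᶻ-flip (distinct i l)))))
                        (#-complement (λ i → y <ᶻ own i))
      L≡ : L ≡ # (λ i → y <ᶻ extra i) + #own>y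
      L≡ = length-filterᵇ-rearr extra own y
      few<L : t₂ + z < L
      few<L = ℕP.≤-<-trans few (begin-strict
        #extra≥x + J       <⟨ ℕP.+-monoʳ-< #extra≥x (to (#-downClosed _ own>y-closed j) (<⇒<ᶻ y<x)) ⟩
        #extra≥x + #own>y  ≤⟨ ℕP.+-monoˡ-≤ #own>y (#-mono {P = λ i → x ℤ.≤ᵇ extra i} {Q = λ i → y <ᶻ extra i}
                                                                              (λ i x≤e → <⇒<ᶻ (ℤP.<-≤-trans y<x (ℤP.≤ᵇ⇒≤ x≤e)))) ⟩
        # (λ i → y <ᶻ extra i) + #own>y  ≡⟨ L≡ ⟨
        L                                ∎)
        where open ℕP.≤-Reasoning
      N≡ : N l ≡ + (L ∸ (t₂ + z))
      N≡ = begin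
        N l                                                 ≡⟨ N-arithmetic _ t₁ _ _ #own>y t₂ z (counts) ⟩
        + (# (λ i → y <ᶻ extra i) + #own>y) ℤ.- + (t₂ + z)  ≡⟨ cong (λ k → + k ℤ.- + (t₂ + z)) (sym L≡) ⟩
        + L ℤ.- + (t₂ + z)                                  ≡⟨ pos-∸ (ℕP.<⇒≤ few<L) ⟩
        + (L ∸ (t₂ + z))                                    ∎
        where
        open ≡-Reasoning
        counts : # (λ i → T′ i ∧ (toℕ l ℕ.<ᵇ toℕ i)) + suc z + t₂ ≡ #own>y + # (λ i → not (U i) ∧ (own i <ᶻ y)) + t₁
        counts = begin
          # (λ i → T′ i ∧ (toℕ l ℕ.<ᵇ toℕ i)) + suc z + t₂  ≡⟨ cong (λ k → k + t₂) (cong₂ _+_ after-l (cong suc (sym l≡z))) ⟩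
          r ∸ suc (toℕ l) + suc (toℕ l) + t₂                ≡⟨ cong (_+ t₂) (ℕP.m∸n+n≡m (FinP.toℕ<n l)) ⟩
          r + t₂                                            ≡⟨ W≡ ⟩
          p + t₁                                            ≡⟨ cong (_+ t₁) own-split ⟨
          #own>y + # (λ i → not (U i) ∧ (own i <ᶻ y)) + t₁  ∎

    bound-if-sums-fail : ¬ T ((+ t₁) <ᶻ q) → #extra≥x + J < t₂ + z → sums-ok ≡ false → g (t₀ + z) ℤ.≤ x
    bound-if-sums-fail q≤t₁ many sums-fail =
      ℤP.≮⇒≥ (λ x<g → subst T sums-fail (subst T (sym sums-ok≡) (ℤP.≤⇒≤ᵇ (dominated x<g))))
      where
      q′ = t₂ + z ∸ suc J
      1+q′+J : suc q′ + J ≡ t₂ + z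
      1+q′+J = trans (sym (ℕP.+-suc q′ J)) (ℕP.m∸n+n≡m (ℕP.≤-<-trans (ℕP.m≤n+m J #extra≥x) many))
      q≡1+q′ : q ≡ + suc q′
      q≡1+q′ = trans q≡ (trans (cong (λ k → + k ℤ.- + J) (sym 1+q′+J))
                         (trans (pos-∸ (ℕP.m≤n+m J (suc q′))) (cong +_ (ℕP.m+n∸n≡m (suc q′) J))))
      q′<t₁ : q′ < t₁
      q′<t₁ = ℤP.drop‿+≤+ (subst (ℤ._≤ + t₁) q≡1+q′ (≮ᶻ⇒≥ q≤t₁))
      extra<x : nth extra q′ ℤ.< x
      extra<x = subst (ℤ._< x) (nth-fromℕ< extra q′<t₁) (ℤP.≰⇒> (λ x≤e → ℕP.<⇒≱
        (subst (_< #extra≥x) (FinP.toℕ-fromℕ< q′<t₁) (to (#-downClosed _ closed (fromℕ< q′<t₁)) (ℤP.≤⇒≤ᵇ x≤e)))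
        (ℕP.≤-pred (ℕP.+-cancelʳ-< J #extra≥x (suc q′) (subst (#extra≥x + J <_) (sym 1+q′+J) many)))))
        where
        closed : DownClosed (λ i → x ℤ.≤ᵇ extra i)
        closed i i′ i≤i′ x≤e = ℤP.≤⇒≤ᵇ (ℤP.≤-trans (ℤP.≤ᵇ⇒≤ {x} {extra i′} x≤e) (extra-partition i i′ i≤i′))
      dominated : x ℤ.< g (t₀ + z) →
        tailSum (nth own) p J ℤ.+ tailSum (nth extra) t₁ (suc q′) ℤ.≤ tailSum (nth other) r z
      dominated x<g = ℤP.≤-trans
        (M.dominated-at-crossing q′<t₁ J<p own<g (subst (nth extra q′ ℤ.<_) (sym (nth-toℕ own j)) extra<x))
        (subst (ℤ._≤ tailSum (nth other) r z) (cong₂ (tailSum g) W≡ (sym 1+q′+J)) (M′.g-tail≤d-tail z z≤r))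
        where
        own<g : nth own J ℤ.< g (q′ + J)
        own<g = subst₂ ℤ._<_ (sym (nth-toℕ own j)) (cong g (sym (ℕP.suc-injective (trans 1+q′+J (cong (_+ z) t₂≡))))) x<g
      own-tail : sumSel (λ i → not (U i) ∧ (toℕ j ℕ.<ᵇ toℕ i)) own ℤ.+ own j ≡ tailSum (nth own) p J
      own-tail = begin
        sumSel (λ i → not (U i) ∧ (toℕ j ℕ.<ᵇ toℕ i)) own ℤ.+ own j  ≡⟨ cong (ℤ._+ own j) (sumSel-suffix _ own (suc J) after) ⟩
        tailSum (nth own) p (suc J) ℤ.+ own j                        ≡⟨ ℤP.+-comm _ (own j) ⟩
        own j ℤ.+ tailSum (nth own) p (suc J)                        ≡⟨ cong (ℤ._+ tailSum (nth own) p (suc J)) (nth-toℕ own j) ⟨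
        nth own J ℤ.+ tailSum (nth own) p (suc J)                    ≡⟨ tailSum-step (nth own) p J J<p ⟨
        tailSum (nth own) p J                                        ∎
        where
        open ≡-Reasoning
        after : Suffix (λ i → not (U i) ∧ (toℕ j ℕ.<ᵇ toℕ i)) (suc J)
        after i rewrite U-empty i = mk⇔ (ℕP.<ᵇ⇒< _ _) ℕP.<⇒<ᵇ
      sums-ok≡ : sums-ok ≡ (tailSum (nth own) p J ℤ.+ tailSum (nth extra) t₁ (suc q′) ℤ.≤ᵇ tailSum (nth other) r z)
      sums-ok≡ = cong₃ own-tail (trans (cong (λ k → sumR extra (k ℤ.+ + 1) (+ t₁)) q≡1+q′) (sumR-suffix-+1 extra (suc q′)))
                        (sumSel-suffix selected other z selected-suffix)
        where
        cong₃ : ∀ {u u′ v v′ w w′} → u ≡ u′ → v ≡ v′ → w ≡ w′ →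
          ((fin u ⊕ v) ≤ᵇ∞ fin w) ≡ ((fin u′ ⊕ v′) ≤ᵇ∞ fin w′)
        cong₃ refl refl refl = refl

  decide⇒bound : decide own other extra T′ U j ≡ true → g (t₀ + z) ℤ.≤ x
  decide⇒bound accepted with T? ((+ t₁) <ᶻ q)
  ... | yes t₁<q = bound-if-q-large t₁<q
  ... | no q≤t₁ with minIdx-spec selected
  ...   | inj₁ none = ⊥-elim (something-selected none q≤t₁)
  ...   | inj₂ (l , just≡ , l-selected , l-least) = bound-if-sums-fail q≤t₁ many sums-fail
    where
    rejected : (if among l then false else not sums-ok) ≡ true
    rejected = subst (λ b → (if b then true else (if among l then false else not sums-ok)) ≡ true)
                 (¬T⇒≡false q≤t₁) (trans (sym (decide-just l just≡)) accepted)
    not-among : ¬ T (among l)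
    not-among among-l with subst (λ b → (if b then false else not sums-ok) ≡ true) (to T-≡ among-l) rejected
    ... | ()
    many : #extra≥x + J < t₂ + z
    many = ℕP.≰⇒> (not-among ∘ among-if-few l l-selected l-least)
    sums-fail : sums-ok ≡ false
    sums-fail = trans (sym (not-involutive sums-ok))
                  (cong not (subst (λ b → (if b then false else not sums-ok) ≡ true) (¬T⇒≡false not-among) rejected))

-- The run of the construction

all-reverse : ∀ {A : Set} {P : A → Set} {xs} → All P xs → All P (reverse xs)
all-reverse {xs = []} [] = []
all-reverse {xs = x ∷ xs} (px ∷ pxs) =
  subst (All _) (sym (ListP.unfold-reverse x xs)) (AllP.++⁺ (all-reverse pxs) (px ∷ []))

allPairs-reverse : ∀ {A : Set} {R : A → A → Set} {xs} → AllPairs (λ u v → R v u) xs → AllPairs R (reverse xs)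
allPairs-reverse {xs = []} [] = []
allPairs-reverse {R = R} {xs = x ∷ xs} (px ∷ pxs) = subst (AllPairs R) (sym (ListP.unfold-reverse x xs))
  (AllPairsP.++⁺ (allPairs-reverse pxs) ([] ∷ []) (all-reverse (All.map (_∷ []) px)))

update-same : ∀ {w} (U : Fin w → Bool) j v → update U j v j ≡ v
update-same U j v rewrite to T-≡ (ℕP.≡⇒≡ᵇ (toℕ j) (toℕ j) refl) = refl

update-other : ∀ {w} (U : Fin w → Bool) j v {i} → i ≢ j → update U j v i ≡ U i
update-other U j v {i} i≢j
  rewrite ¬T⇒≡false (i≢j ∘ FinP.toℕ-injective ∘ ℕP.≡ᵇ⇒≡ (toℕ i) (toℕ j)) = refl

private
  t<t+X+1 : ∀ t X → t < t + 0 + X + 1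
  t<t+X+1 t X = subst (t <_) (ℕP.+-comm 1 (t + 0 + X)) (ℕ.s≤s (ℕP.≤-trans (ℕP.m≤m+n t 0) (ℕP.m≤m+n (t + 0) X)))

-- Here q = t + #{i > j | i ∉ U} + 1 exceeds t.
decide-without-other : ∀ {p r t} (own : Fin p → ℤ) (other : Fin r → ℤ) (extra : Fin t → ℤ) T′ U j →
  (∀ i → T′ i ≡ false) → decide own other extra T′ U j ≡ true
decide-without-other {t = t} own other extra T′ U j T′-empty
  rewrite #-none (λ i → T′ i ∧ (other i <ᶻ own j)) (λ i → subst T (cong (_∧ (other i <ᶻ own j)) (T′-empty i)))
        | to T-≡ (<⇒<ᶻ (ℤ.+<+ (t<t+X+1 t (# (λ i → (toℕ j ℕ.<ᵇ toℕ i) ∧ not (U i)))))) = refl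

module Run {m n s k : ℕ} (a : Fin s → ℤ) (d : Fin m → ℤ) (b : Fin k → ℤ) (c : Fin n → ℤ)
           (d-partition : Partition d) (c-partition : Partition c) where

  Event = Fin m ⊎ Fin n

  value : Event → ℤ
  value (inj₁ i) = d i
  value (inj₂ i) = c i

  Before : Event → Event → Set
  Before e e′ = (value e ℤ.≤ value e′) × (e ≢ e′)

  private
    ascending : ∀ {w} (y : Fin w → ℤ) → Partition y →
      AllPairs (λ i i′ → (y i ℤ.≤ y i′) × (i ≢ i′)) (reverse (allFin w))
    ascending y py = allPairs-reverse (allPairs-tabulate _ id
      (λ i i′ i<i′ → py i i′ (ℕP.<⇒≤ i<i′) , λ i′≡i → ℕP.<-irrefl (cong toℕ (sym i′≡i)) i<i′))

    merge-all : ∀ (P : Event → Set) xs ys → All (P ∘ inj₁) xs → All (P ∘ inj₂) ys → All P (mergeOrd d c xs ys)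
    merge-all P [] ys _ pys = AllP.map⁺ pys
    merge-all P (x ∷ xs) ys₀ (px ∷ pxs) pys₀ = go ys₀ pys₀
      where
      go : ∀ ys → All (P ∘ inj₂) ys → All P (mergeOrd d c (x ∷ xs) ys)
      go [] [] = AllP.map⁺ (px ∷ pxs)
      go (y ∷ ys) (py ∷ pys) with d x <ᶻ c y
      ... | true = px ∷ merge-all P xs (y ∷ ys) pxs (py ∷ pys)
      ... | false = py ∷ go ys pys

    inj₁-before : ∀ {i i′} → (d i ℤ.≤ d i′) × (i ≢ i′) → Before (inj₁ i) (inj₁ i′)
    inj₁-before (≤ , ≢) = ≤ , λ { refl → ≢ refl }

    inj₂-before : ∀ {i i′} → (c i ℤ.≤ c i′) × (i ≢ i′) → Before (inj₂ i) (inj₂ i′)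
    inj₂-before (≤ , ≢) = ≤ , λ { refl → ≢ refl }

    merge-sorted : ∀ xs ys → AllPairs (λ i i′ → (d i ℤ.≤ d i′) × (i ≢ i′)) xs →
      AllPairs (λ i i′ → (c i ℤ.≤ c i′) × (i ≢ i′)) ys → AllPairs Before (mergeOrd d c xs ys)
    merge-sorted [] ys _ sy = AllPairsP.map⁺ (AllPairs.map inj₂-before sy)
    merge-sorted (x ∷ xs) ys₀ (x≤xs ∷ sx) sy₀ = go ys₀ sy₀
      where
      go : ∀ ys → AllPairs (λ i i′ → (c i ℤ.≤ c i′) × (i ≢ i′)) ys → AllPairs Before (mergeOrd d c (x ∷ xs) ys)
      go [] [] = AllPairsP.map⁺ (AllPairs.map inj₁-before (x≤xs ∷ sx))
      go (y ∷ ys) (y≤ys ∷ sy) with d x <ᶻ c y in x<y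
      ... | true = merge-all (Before (inj₁ x)) xs (y ∷ ys) (All.map inj₁-before x≤xs)
                     ((ℤP.<⇒≤ dx<cy , λ ()) ∷ All.map (λ (≤ , _) → ℤP.≤-trans (ℤP.<⇒≤ dx<cy) ≤ , λ ()) y≤ys)
                   ∷ merge-sorted xs (y ∷ ys) sx (y≤ys ∷ sy)
        where dx<cy = <ᶻ⇒< (subst T (sym x<y) _)
      ... | false = merge-all (Before (inj₂ y)) (x ∷ xs) ys
                      ((cy≤dx , λ ()) ∷ All.map (λ (≤ , _) → ℤP.≤-trans cy≤dx ≤ , λ ()) x≤xs) (All.map inj₂-before y≤ys)
                    ∷ go ys sy
        where cy≤dx = ≮ᶻ⇒≥ (subst T x<y)

    merge-complete : ∀ xs ys i → i ∈ xs → inj₁ i ∈ mergeOrd d c xs ys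
    merge-complete (x ∷ xs) ys₀ i i∈ = go ys₀
      where
      go : ∀ ys → inj₁ i ∈ mergeOrd d c (x ∷ xs) ys
      go [] = ∈P.∈-map⁺ inj₁ i∈
      go (y ∷ ys) with d x <ᶻ c y
      ... | false = there (go ys)
      ... | true = head-or-tail i∈
        where
        head-or-tail : i ∈ x ∷ xs → inj₁ i ∈ inj₁ x ∷ mergeOrd d c xs (y ∷ ys)
        head-or-tail (here refl) = here refl
        head-or-tail (there i∈xs) = there (merge-complete xs (y ∷ ys) i i∈xs)

  order-sorted : AllPairs Before (order d c)
  order-sorted = merge-sorted _ _ (ascending d d-partition) (ascending c c-partition)

  order-complete : ∀ i → inj₁ i ∈ order d c
  order-complete i = merge-complete _ _ i (AnyP.reverse⁺ (∈P.∈-allFin i))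

  process : State m n → Event → State m n
  process st e = step a d b c e st

  private
    Δ-untouched : ∀ L st i → All (_≢ inj₁ i) L → proj₂ (foldl process st L) i ≡ proj₂ st i
    Δ-untouched [] st i _ = refl
    Δ-untouched (inj₁ j ∷ L) (S , Δ) i (j≢i ∷ rest) =
      trans (Δ-untouched L _ i rest) (update-other Δ j _ (λ { refl → j≢i refl }))
    Δ-untouched (inj₂ j ∷ L) (S , Δ) i (_ ∷ rest) = Δ-untouched L _ i rest

    S-untouched : ∀ L st i → All (_≢ inj₂ i) L → proj₁ (foldl process st L) i ≡ proj₁ st i
    S-untouched [] st i _ = refl
    S-untouched (inj₁ j ∷ L) (S , Δ) i (_ ∷ rest) = S-untouched L _ i rest
    S-untouched (inj₂ j ∷ L) (S , Δ) i (j≢i ∷ rest) =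
      trans (S-untouched L _ i rest) (update-other S j _ (λ { refl → j≢i refl }))

    S-origin : ∀ L st i → proj₁ (foldl process st L) i ≡ true → (proj₁ st i ≡ true) ⊎ (inj₂ i ∈ L)
    S-origin [] st i i∈S = inj₁ i∈S
    S-origin (inj₁ j ∷ L) (S , Δ) i i∈S with S-origin L _ i i∈S
    ... | inj₁ i∈S′ = inj₁ i∈S′
    ... | inj₂ i∈L = inj₂ (there i∈L)
    S-origin (inj₂ j ∷ L) (S , Δ) i i∈S with S-origin L _ i i∈S
    ... | inj₂ i∈L = inj₂ (there i∈L)
    ... | inj₁ i∈S′ with i Fin.≟ j
    ...   | yes refl = inj₂ (here refl)
    ...   | no i≢j = inj₁ (trans (sym (update-other S j _ i≢j)) i∈S′)

  record Accepted (S : Fin n → Bool) : Set where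
    field
      j : Fin n
      j∈S : S j ≡ true
      j-least : ∀ i → S i ≡ true → c j ℤ.≤ c i
      Δ₀ : Fin m → Bool
      S₀ : Fin n → Bool
      S₀-empty : ∀ i → S₀ i ≡ false
      Δ₀-below : ∀ i → d i ℤ.< c j → Δ₀ i ≡ true
      accepted : decide c d b Δ₀ S₀ j ≡ true

  -- While S is empty every d_i goes into Δ; the first c_j put into S stays
  -- its least element, since larger entries are processed later.
  module _ (last : Fin m) (last<c : ∀ j → d last ℤ.< c j) where

    Outcome : State m n → Set
    Outcome st = (proj₂ st last ≡ true) × ((∀ i → proj₁ st i ≡ false) ⊎ Accepted (proj₁ st))

    private
      phase : ∀ L st → AllPairs Before L → (∀ i → proj₁ st i ≡ false) →
        (∀ i → ¬ (inj₁ i ∈ L) → proj₂ st i ≡ true) → Outcome (foldl process st L)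
      phase [] st _ S-empty Δ-done = Δ-done last (λ ()) , inj₁ S-empty
      phase (inj₁ i ∷ L) (S , Δ) (_ ∷ sorted) S-empty Δ-done
        rewrite decide-without-other d c a S Δ i S-empty = phase L (S , update Δ i true) sorted S-empty Δ-done′
        where
        Δ-done′ : ∀ i′ → ¬ (inj₁ i′ ∈ L) → update Δ i true i′ ≡ true
        Δ-done′ i′ i′∉L with i′ Fin.≟ i
        ... | yes refl = update-same Δ i true
        ... | no i′≢i = trans (update-other Δ i true i′≢i)
                              (Δ-done i′ (λ { (here refl) → i′≢i refl ; (there i′∈L) → i′∉L i′∈L }))
      phase (inj₂ j ∷ L) (S , Δ) (j-first ∷ sorted) S-empty Δ-done with decide c d b Δ S j in accepted
      ... | false = phase L (update S j false , Δ) sorted S-empty′ (λ i i∉L → Δ-done i (λ { (there i∈L) → i∉L i∈L }))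
        where
        S-empty′ : ∀ i → update S j false i ≡ false
        S-empty′ i with i Fin.≟ j
        ... | yes refl = update-same S j false
        ... | no i≢j = trans (update-other S j false i≢j) (S-empty i)
      ... | true = trans (Δ-untouched L st′ last (All.map (λ { (≤ , _) refl → ℤP.<⇒≱ (last<c j) ≤ }) j-first))
                         (Δ-below last (last<c j))
                 , inj₂ record
                   { j = j
                   ; j∈S = trans (S-untouched L st′ j (All.map (λ (_ , ≢) e → ≢ (sym e)) j-first)) (update-same S j true)
                   ; j-least = j-least
                   ; Δ₀ = Δ ; S₀ = S ; S₀-empty = S-empty ; Δ₀-below = Δ-below ; accepted = accepted }
        where
        st′ = (update S j true , Δ)
        Δ-below : ∀ i → d i ℤ.< c j → Δ i ≡ true
        Δ-below i di<cj = Δ-done i (λ { (here ()) ; (there i∈L) → ℤP.<⇒≱ di<cj (proj₁ (All.lookup j-first i∈L)) })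
        j-least : ∀ i → proj₁ (foldl process st′ L) i ≡ true → c j ℤ.≤ c i
        j-least i i∈S with S-origin L st′ i i∈S
        ... | inj₂ i∈L = proj₁ (All.lookup j-first i∈L)
        ... | inj₁ i∈S′ with i Fin.≟ j
        ...   | yes refl = ℤP.≤-refl
        ...   | no i≢j with trans (sym (S-empty i)) (trans (sym (update-other S j true i≢j)) i∈S′)
        ...     | ()

    run-when-d-first : Outcome (runSD a d b c)
    run-when-d-first = phase (order d c) _ order-sorted (λ _ → refl) (λ i i∉ → ⊥-elim (i∉ (order-complete i)))

module Swap {m n s k : ℕ} (a : Fin s → ℤ) (d : Fin m → ℤ) (b : Fin k → ℤ) (c : Fin n → ℤ)
            (distinct : ∀ i j → c i ≢ d j) where

  private
    merge-swap : ∀ xs ys → mergeOrd c d ys xs ≡ map Sum.swap (mergeOrd d c xs ys)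
    merge-swap [] [] = refl
    merge-swap [] (y ∷ ys) = ListP.map-∘ (y ∷ ys)
    merge-swap (x ∷ xs) ys₀ = go ys₀
      where
      go : ∀ ys → mergeOrd c d ys (x ∷ xs) ≡ map Sum.swap (mergeOrd d c (x ∷ xs) ys)
      go [] = ListP.map-∘ (x ∷ xs)
      go (y ∷ ys) rewrite <ᶻ-flip (distinct y x) with d x <ᶻ c y
      ... | true = cong (inj₂ x ∷_) (merge-swap xs (y ∷ ys))
      ... | false = cong (inj₁ y ∷_) (go ys)

    fold-swap : ∀ L st → foldl (λ st e → step b c a d e st) (Product.swap st) (map Sum.swap L)
                         ≡ Product.swap (foldl (λ st e → step a d b c e st) st L)
    fold-swap [] st = refl
    fold-swap (inj₁ j ∷ L) (S , Δ) = fold-swap L (S , update Δ j (decide d c a S Δ j))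
    fold-swap (inj₂ j ∷ L) (S , Δ) = fold-swap L (update S j (decide c d b Δ S j) , Δ)

  run-swap : runSD b c a d ≡ Product.swap (runSD a d b c)
  run-swap = trans (cong (foldl (λ st e → step b c a d e st) _) (merge-swap (reverse (allFin m)) (reverse (allFin n))))
                   (fold-swap (order d c) _)

  setS-swap : setS b c a d ≡ setΔ a d b c
  setS-swap = cong proj₁ run-swap

  setΔ-swap : setΔ b c a d ≡ setS a d b c
  setΔ-swap = cong proj₂ run-swap

nth-cong : ∀ {w} {f h : Fin w → ℤ} → (∀ i → f i ≡ h i) → ∀ u → nth f u ≡ nth h u
nth-cong {zero} _ u = refl
nth-cong {suc w} f≗h zero = f≗h Fin.zero
nth-cong {suc w} f≗h (suc u) = nth-cong (f≗h ∘ Fin.suc) u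

nth-cast : ∀ {w₁ w₂} (e : w₁ ≡ w₂) (g : Fin w₂ → ℤ) u → nth (g ∘ cast e) u ≡ nth g u
nth-cast refl g = nth-cong (λ i → cong g (FinP.cast-is-id refl i))

partition-cast : ∀ {w₁ w₂} (e : w₁ ≡ w₂) {g : Fin w₂ → ℤ} → Partition g → Partition (g ∘ cast e)
partition-cast e pg i j i≤j = pg (cast e i) (cast e j) (subst₂ _≤_ (sym (FinP.toℕ-cast e i)) (sym (FinP.toℕ-cast e j)) i≤j)

partition-last : ∀ {w} (y : Fin (suc w) → ℤ) → Partition y → ∀ i → y (Fin.fromℕ w) ℤ.≤ y i
partition-last {w} y py i = py i (Fin.fromℕ w) (subst (toℕ i ≤_) (sym (FinP.toℕ-fromℕ w)) (ℕP.≤-pred (FinP.toℕ<n i)))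

module _ {w} (y : Fin w → ℤ) (py : Partition y) (x : ℤ) where

  private
    above-closed : DownClosed (λ i → x <ᶻ y i)
    above-closed i i′ i≤i′ x<y = <⇒<ᶻ (ℤP.<-≤-trans (<ᶻ⇒< x<y) (py i i′ i≤i′))

  countAbove-above : ∀ i → i < countAbove y (fin x) → x ℤ.< nth y i
  countAbove-above i i<z = subst (x ℤ.<_) (nth-fromℕ< y i<w)
    (<ᶻ⇒< (from (#-downClosed _ above-closed (fromℕ< i<w)) (subst (_< countAbove y (fin x)) (sym (FinP.toℕ-fromℕ< i<w)) i<z)))
    where i<w = ℕP.<-≤-trans i<z (#-≤ _)

  countAbove-below : ∀ i → countAbove y (fin x) ≤ i → i < w → nth y i ℤ.≤ x
  countAbove-below i z≤i i<w = subst (ℤ._≤ x) (nth-fromℕ< y i<w)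
    (≮ᶻ⇒≥ (λ x<y → ℕP.<⇒≱ (subst (_< countAbove y (fin x)) (FinP.toℕ-fromℕ< i<w)
                                  (to (#-downClosed _ above-closed (fromℕ< i<w)) x<y)) z≤i))

countAbove-all : ∀ {w} (y : Fin w → ℤ) x → (∀ i → x ℤ.< y i) → countAbove y (fin x) ≡ w
countAbove-all {w} y x x<y = #-suffix _ 0 (λ i → mk⇔ (λ _ → z≤n) (λ _ → <⇒<ᶻ (x<y i)))

extra-last≤ : ∀ {p s₀} {d : Fin p → ℤ} {a g : ℕ → ℤ} → Majorized p (suc s₀) (nth d) a g → Partition d →
  ∀ x → g (s₀ + countAbove d (fin x)) ℤ.≤ x → a s₀ ℤ.≤ x
extra-last≤ {d = d} M pd x = MajorizedProperties.a-last≤ M refl (#-≤ _) (countAbove-above d pd x) (countAbove-below d pd x)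

-- v ≥ g_{z+t} and v ≥ extra_t (1-based, z = #{i | other_i > v}), unless v = +∞
LastBounds : ∀ {r} → (ℕ → ℤ) → ℕ → (Fin r → ℤ) → (ℕ → ℤ) → ℤ∞ → Set
LastBounds g t₀ other extra v =
  v ≡ +∞ ⊎ Σ ℤ λ x → (v ≡ fin x) × (g (t₀ + countAbove other (fin x)) ℤ.≤ x) × (extra t₀ ℤ.≤ x)

LastBounds⇒at : ∀ {W r t₀} (g : Fin W → ℤ) (extra : Fin (suc t₀) → ℤ) (other : Fin r → ℤ) {v} → t₀ + r < W →
  LastBounds (nth g) t₀ other (nth extra) v →
  (at g (+ (countAbove other v + suc t₀)) ≤∞ v) × (at extra (+ suc t₀) ≤∞ v)
LastBounds⇒at g extra other _ (inj₁ refl) = ≤+∞ , ≤+∞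
LastBounds⇒at {t₀ = t₀} g extra other t₀+r<W (inj₂ (x , refl , g≤x , e≤x)) =
  subst (_≤∞ fin x) (sym at-g) (fin≤fin g≤x) , subst (_≤∞ fin x) (sym (at-inside extra t₀ ℕP.≤-refl)) (fin≤fin e≤x)
  where
  z = countAbove other (fin x)
  at-g : at g (+ (z + suc t₀)) ≡ fin (nth g (t₀ + z))
  at-g = trans (cong (λ i → at g (+ i)) (trans (ℕP.+-suc z t₀) (cong suc (ℕP.+-comm z t₀))))
               (at-inside g (t₀ + z) (ℕP.≤-<-trans (ℕP.+-monoʳ-≤ t₀ (#-≤ _)) t₀+r<W))

bounds-when-d-first : ∀ {m₀ n₀ s₀ k₀} (a : Fin (suc s₀) → ℤ) (d : Fin (suc m₀) → ℤ) (b : Fin (suc k₀) → ℤ)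
  (c : Fin (suc n₀) → ℤ) {g : ℕ → ℤ} → Partition d → Partition b → Partition c → (∀ i j → c i ≢ d j) →
  suc m₀ + suc s₀ ≡ suc n₀ + suc k₀ →
  Majorized (suc m₀) (suc s₀) (nth d) (nth a) g → Majorized (suc n₀) (suc k₀) (nth c) (nth b) g →
  (∀ j → d (Fin.fromℕ m₀) ℤ.< c j) →
  LastBounds g s₀ d (nth a) (minSel (setS a d b c) c) × LastBounds g k₀ c (nth b) (minSel (setΔ a d b c) d)
bounds-when-d-first {m₀} {n₀} {s₀} {k₀} a d b c {g} pd pb pc distinct eq Mᵈ Mᶜ last<c = c-side , d-side
  where
  open Run a d b c pd pc
  last = Fin.fromℕ m₀
  outcome = run-when-d-first last last<c

  d-side : LastBounds g k₀ c (nth b) (minSel (setΔ a d b c) d)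
  d-side = inj₂ (d last , minSel-attained (setΔ a d b c) d last (from T-≡ (proj₁ outcome)) (λ i _ → partition-last d pd i) , g≤ ,
                 extra-last≤ Mᶜ pc (d last) g≤)
    where
    -- every c lies above d_last, so the index is m + s (1-based), where condition (i) applies
    g≤ : g (k₀ + countAbove c (fin (d last))) ℤ.≤ d last
    g≤ = subst₂ (λ i y → g i ℤ.≤ y) index (trans (cong (nth d) (sym (FinP.toℕ-fromℕ m₀))) (nth-toℕ d last))
           (Majorized.shifted Mᵈ m₀ ℕP.≤-refl)
      where
      index : m₀ + suc s₀ ≡ k₀ + countAbove c (fin (d last))
      index = begin
        m₀ + suc s₀                       ≡⟨ ℕP.suc-injective eq ⟩
        n₀ + suc k₀                       ≡⟨ ℕP.+-suc n₀ k₀ ⟩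
        suc n₀ + k₀                       ≡⟨ ℕP.+-comm (suc n₀) k₀ ⟩
        k₀ + suc n₀                       ≡⟨ cong (λ z → k₀ + z) (countAbove-all c (d last) last<c) ⟨
        k₀ + countAbove c (fin (d last))  ∎
        where open ≡-Reasoning

  c-side : LastBounds g s₀ d (nth a) (minSel (setS a d b c) c)
  c-side with proj₂ outcome
  ... | inj₁ S-empty = inj₁ (minSel-none (setS a d b c) c (λ i → subst T (S-empty i)))
  ... | inj₂ acc = inj₂ (c j , minSel-attained (setS a d b c) c j (from T-≡ j∈S) (λ i → j-least i ∘ to T-≡) ,
                         g≤ , extra-last≤ Mᵈ pd (c j) g≤)
    where
    open Accepted acc
    g≤ : g (s₀ + countAbove d (fin (c j))) ℤ.≤ c j
    g≤ = Decision.decide⇒bound eq refl pc pd pb Mᶜ Mᵈ distinct Δ₀ S₀ j S₀-empty Δ₀-below accepted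

bounds-when-c-first : ∀ {m₀ n₀ s₀ k₀} (a : Fin (suc s₀) → ℤ) (d : Fin (suc m₀) → ℤ) (b : Fin (suc k₀) → ℤ)
  (c : Fin (suc n₀) → ℤ) {g : ℕ → ℤ} → Partition a → Partition d → Partition c → (∀ i j → c i ≢ d j) →
  suc m₀ + suc s₀ ≡ suc n₀ + suc k₀ →
  Majorized (suc m₀) (suc s₀) (nth d) (nth a) g → Majorized (suc n₀) (suc k₀) (nth c) (nth b) g →
  (∀ j → c (Fin.fromℕ n₀) ℤ.< d j) →
  LastBounds g s₀ d (nth a) (minSel (setS a d b c) c) × LastBounds g k₀ c (nth b) (minSel (setΔ a d b c) d)
bounds-when-c-first a d b c {g} pa pd pc distinct eq Mᵈ Mᶜ last<d =
  Product.swap (subst₂ (λ S Δ → LastBounds g _ c (nth b) (minSel S d) × LastBounds g _ d (nth a) (minSel Δ c))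
    (Swap.setS-swap a d b c distinct) (Swap.setΔ-swap a d b c distinct)
    (bounds-when-d-first b c a d pc pa pd (λ i j → distinct j i ∘ sym) (sym eq) Mᶜ Mᵈ last<d))

lemma3p13 : (m n s k : ℕ) → 1 ≤ m → 1 ≤ n → 1 ≤ s → 1 ≤ k → (eq : m + s ≡ n + k)
  → (a : Fin s → ℤ) (d : Fin m → ℤ) (b : Fin k → ℤ) (c : Fin n → ℤ)
  → Partition a → Partition d → Partition b → Partition c
  → (∀ (i : Fin n) (j : Fin m) → c i ≢ d j)
  → (g : Fin (m + s) → ℤ) → Partition g
  → g ≺″[ d , a ] → (λ i → g (cast (sym eq) i)) ≺″[ c , b ]
  → let S = setS a d b c
        Δ = setΔ a d b c
        cTop = minSel S c
        dTop = minSel Δ d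
    in (at g (+ (countAbove d cTop + s)) ≤∞ cTop)
       × (at g (+ (countAbove c dTop + k)) ≤∞ dTop)
       × (at a (+ s) ≤∞ cTop)
       × (at b (+ k) ≤∞ dTop)
lemma3p13 (suc m₀) (suc n₀) (suc s₀) (suc k₀) _ _ _ _ eq a d b c pa pd pb pc distinct g pg g≺da g≺cb =
  proj₁ c-goal , proj₁ d-goal , proj₂ c-goal , proj₂ d-goal
  where
  Mᵈ = ≺″⇒Majorized d a g pd pa pg g≺da
  Mᶜ = Majorized-cong (nth-cast (sym eq) g) (≺″⇒Majorized c b _ pc pb (partition-cast (sym eq) pg) g≺cb)
  bounds : LastBounds (nth g) s₀ d (nth a) (minSel (setS a d b c) c) × LastBounds (nth g) k₀ c (nth b) (minSel (setΔ a d b c) d)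
  bounds with d (Fin.fromℕ m₀) ℤ.<? c (Fin.fromℕ n₀)
  ... | yes d<c = bounds-when-d-first a d b c pd pb pc distinct eq Mᵈ Mᶜ (λ j → ℤP.<-≤-trans d<c (partition-last c pc j))
  ... | no d≮c = bounds-when-c-first a d b c pa pd pc distinct eq Mᵈ Mᶜ
                   (λ j → ℤP.<-≤-trans (ℤP.≤∧≢⇒< (ℤP.≮⇒≥ d≮c) (distinct _ _)) (partition-last d pd j))
  c-goal = LastBounds⇒at g a d (ℕP.≤-reflexive (ℕP.+-comm (suc s₀) (suc m₀))) (proj₁ bounds)
  d-goal = LastBounds⇒at g b c (ℕP.≤-reflexive (trans (ℕP.+-comm (suc k₀) (suc n₀)) (sym eq))) (proj₂ bounds)
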